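{- Let $G$ be a König–Egerváry graph and $G_0=G-N[\mathrm{core}(G)]$. If $G_0$ has a unique perfect matching, then an edge of $G_0$ is $\alpha$-critical in $G_0$ if and only if it is $\mu$-critical in $G_0$.
   Context: All graphs are finite and simple; "graph" means a connected graph with at least one edge ($G_0$ need not be connected; definitions apply to it as well). $\alpha(G)$ is the stability number, $\mu(G)$ the maximum matching size, $n(G)=|V(G)|$; $G$ is König–Egerváry if $\alpha(G)+\mu(G)=n(G)$. $\Omega(G)$ is the set of maximum stable sets, $\mathrm{core}(G)=\bigcap\{S:S\in\Omega(G)\}$. For $A\subseteq V(G)$, $N(A)$ is the set of vertices adjacent to some vertex of $A$, $N[A]=A\cup N(A)$, and $G-A$ is the subgraph induced by $V(G)-A$. An edge $e$ of a graph $H$ is $\alpha$-critical in $H$ if $\alpha(H-e)>\alpha(H)$ and $\mu$-critical in $H$ if $\mu(H-e)<\mu(H)$, where $H-e$ is $H$ with the edge $e$ deleted. -}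

module Defs where

open import Data.Nat using (ℕ; zero; suc; _+_; _<_; _⊔_)
import Data.Nat
import Data.Bool
open import Data.Bool using (Bool; true; false; _∧_; _∨_; not; if_then_else_)
open import Data.Bool.Properties using (∧-comm; ∨-comm; ∧-zeroʳ)
import Data.Bool.Properties as BoolP
open import Data.Fin using (Fin; toℕ)
open import Data.Fin.Properties using (all?) renaming (_≟_ to _≟ᶠ_)
open import Data.Fin.Subset using (Subset; _∈_; _⊆_; ∁; _∩_; _∪_; _─_; ⋂; ∣_∣; inside; outside)
open import Data.Fin.Subset.Properties using (_∈?_; _⊆?_; x∈p∩q⁺; x∉p⇒x∈∁p)
open import Data.Vec using (Vec; []; _∷_; lookup; tabulate)
open import Data.Vec.Properties using ([]=⇒lookup)
open import Data.List using (List; []; _∷_; [_]; map; filter; _++_; foldr; allFin)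
open import Data.Nat.ListAction using (sum)
open import Data.Bool.ListAction using (any)
open import Data.Empty using (⊥)
open import Data.Product using (Σ; ∃; ∃-syntax; _×_; _,_)
open import Relation.Nullary using (Dec; yes; no; ¬_; does)
open import Relation.Nullary.Decidable using (⌊_⌋; _×-dec_; _→-dec_)
open import Relation.Binary.PropositionalEquality using (_≡_; refl; sym; trans; cong; cong₂)

-- The vertex set is an arbitrary subset V of
-- Fin n (so induced subgraphs and edge deletions are again graphs of
-- the same type); E is a symmetric, irreflexive Boolean adjacency
-- relation whose edges have both ends in V.

record Graph (n : ℕ) : Set where
  field
    V     : Subset n
    E     : Fin n → Fin n → Bool
    E-sym : ∀ i j → E i j ≡ E j i
    E-irr : ∀ i → E i i ≡ false
    E-V   : ∀ i j → E i j ≡ true → i ∈ V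

open Graph public

order : ∀ {n} → Graph n → ℕ
order G = ∣ V G ∣

data Reach {n} (G : Graph n) : Fin n → Fin n → Set where
  here : ∀ {i} → Reach G i i
  step : ∀ {i j k} → E G i j ≡ true → Reach G j k → Reach G i k

Connected : ∀ {n} → Graph n → Set
Connected G = ∀ i j → i ∈ V G → j ∈ V G → Reach G i j

HasEdge : ∀ {n} → Graph n → Set
HasEdge G = ∃[ i ] ∃[ j ] (E G i j ≡ true)

allSubsets : ∀ n → List (Subset n)
allSubsets zero    = [ [] ]
allSubsets (suc n) = map (inside ∷_) (allSubsets n) ++ map (outside ∷_) (allSubsets n)

allVecs : ∀ {A : Set} → List A → ∀ k → List (Vec A k)
allVecs xs zero    = [ [] ]
allVecs xs (suc k) = foldr (λ x acc → map (x ∷_) (allVecs xs k) ++ acc) [] xs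

allRels : ∀ n → List (Fin n → Fin n → Bool)
allRels n = map (λ rows i j → lookup (lookup rows i) j) (allVecs (allSubsets n) n)

maximum : List ℕ → ℕ
maximum = foldr _⊔_ 0

Stable : ∀ {n} → Graph n → Subset n → Set
Stable G S = S ⊆ V G × (∀ i j → i ∈ S → j ∈ S → E G i j ≡ false)

stable? : ∀ {n} (G : Graph n) (S : Subset n) → Dec (Stable G S)
stable? G S = (S ⊆? V G) ×-dec
  all? (λ i → all? (λ j → (i ∈? S) →-dec ((j ∈? S) →-dec (E G i j Data.Bool.≟ false))))

α : ∀ {n} → Graph n → ℕ
α {n} G = maximum (map ∣_∣ (filter (stable? G) (allSubsets n)))

MaxStable : ∀ {n} → Graph n → Subset n → Set
MaxStable G S = Stable G S × ∣ S ∣ ≡ α G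

maxStable? : ∀ {n} (G : Graph n) (S : Subset n) → Dec (MaxStable G S)
maxStable? G S = stable? G S ×-dec (∣ S ∣ Data.Nat.≟ α G)

Ω : ∀ {n} → Graph n → List (Subset n)
Ω {n} G = filter (maxStable? G) (allSubsets n)

core : ∀ {n} → Graph n → Subset n
core G = ⋂ (Ω G)

-- Matchings and the matching number μ(G).
-- A set of edges is represented by a symmetric Boolean relation M
-- (the edge {i,j} belongs to M iff M i j ≡ true).

Matching : ∀ {n} → Graph n → (Fin n → Fin n → Bool) → Set
Matching G M =
    (∀ i j → M i j ≡ true → E G i j ≡ true)
  × (∀ i j → M i j ≡ M j i)
  × (∀ i j k → M i j ≡ true → M i k ≡ true → j ≡ k)

matching? : ∀ {n} (G : Graph n) M → Dec (Matching G M)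
matching? G M =
      all? (λ i → all? (λ j → (M i j Data.Bool.≟ true) →-dec (E G i j Data.Bool.≟ true)))
  ×-dec all? (λ i → all? (λ j → M i j Data.Bool.≟ M j i))
  ×-dec all? (λ i → all? (λ j → all? (λ k →
          (M i j Data.Bool.≟ true) →-dec ((M i k Data.Bool.≟ true) →-dec (j ≟ᶠ k)))))

edgeCount : ∀ {n} → (Fin n → Fin n → Bool) → ℕ
edgeCount {n} M =
  sum (map (λ i → sum (map (λ j →
        if ⌊ toℕ i Data.Nat.<? toℕ j ⌋ ∧ M i j then 1 else 0) (allFin n))) (allFin n))

μ : ∀ {n} → Graph n → ℕ
μ {n} G = maximum (map edgeCount (filter (matching? G) (allRels n)))

KönigEgerváry : ∀ {n} → Graph n → Set
KönigEgerváry G = α G + μ G ≡ order G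

PerfectMatching : ∀ {n} → Graph n → (Fin n → Fin n → Bool) → Set
PerfectMatching G M = Matching G M × (∀ i → i ∈ V G → ∃[ j ] (M i j ≡ true))

HasUniquePerfectMatching : ∀ {n} → Graph n → Set
HasUniquePerfectMatching G =
  ∃[ M ] (PerfectMatching G M × (∀ M′ → PerfectMatching G M′ → ∀ i j → M′ i j ≡ M i j))

N : ∀ {n} → Graph n → Subset n → Subset n
N {n} G A = tabulate (λ j → any (λ i → lookup A i ∧ E G i j) (allFin n))

N[_]_ : ∀ {n} → Subset n → Graph n → Subset n
N[ A ] G = A ∪ N G A

private
  notTrue : ∀ {n} {A : Subset n} {i} → not (lookup A i) ≡ true → i ∈ ∁ A
  notTrue {A = A} {i} p = x∉p⇒x∈∁p (λ i∈A → go (trans (sym (cong not ([]=⇒lookup i∈A))) p))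
    where go : false ≡ true → ⊥
          go ()

  ∧-l : ∀ {a b} → a ∧ b ≡ true → a ≡ true
  ∧-l {true} _ = refl

  ∧-r : ∀ {a b} → a ∧ b ≡ true → b ≡ true
  ∧-r {true} p = p


_-ᵛ_ : ∀ {n} → Graph n → Subset n → Graph n
G -ᵛ A = record
  { V     = V G ∩ ∁ A
  ; E     = λ i j → E G i j ∧ (not (lookup A i) ∧ not (lookup A j))
  ; E-sym = λ i j → cong₂ _∧_ (E-sym G i j) (∧-comm (not (lookup A i)) (not (lookup A j)))
  ; E-irr = λ i → cong (_∧ _) (E-irr G i)
  ; E-V   = λ i j p → x∈p∩q⁺ (E-V G i j (∧-l p) , notTrue {A = A} (∧-l (∧-r {E G i j} p)))
  }

isUV : ∀ {n} → Fin n → Fin n → Fin n → Fin n → Bool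
isUV u v i j = (⌊ i ≟ᶠ u ⌋ ∧ ⌊ j ≟ᶠ v ⌋) ∨ (⌊ i ≟ᶠ v ⌋ ∧ ⌊ j ≟ᶠ u ⌋)

private
  isUV-sym : ∀ {n} (u v i j : Fin n) → isUV u v i j ≡ isUV u v j i
  isUV-sym u v i j = trans (cong₂ _∨_ (∧-comm ⌊ i ≟ᶠ u ⌋ ⌊ j ≟ᶠ v ⌋) (∧-comm ⌊ i ≟ᶠ v ⌋ ⌊ j ≟ᶠ u ⌋))
                           (∨-comm (⌊ j ≟ᶠ v ⌋ ∧ ⌊ i ≟ᶠ u ⌋) (⌊ j ≟ᶠ u ⌋ ∧ ⌊ i ≟ᶠ v ⌋))

deleteEdge : ∀ {n} → Graph n → Fin n → Fin n → Graph n
deleteEdge G u v = record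
  { V     = V G
  ; E     = λ i j → E G i j ∧ not (isUV u v i j)
  ; E-sym = λ i j → cong₂ _∧_ (E-sym G i j) (cong not (isUV-sym u v i j))
  ; E-irr = λ i → cong (_∧ _) (E-irr G i)
  ; E-V   = λ i j p → E-V G i j (∧-l p)
  }

αCritical : ∀ {n} → Graph n → Fin n → Fin n → Set
αCritical H u v = α H < α (deleteEdge H u v)

μCritical : ∀ {n} → Graph n → Fin n → Fin n → Set
μCritical H u v = μ (deleteEdge H u v) < μ H

{-# OPTIONS --safe #-}
module Submission where

-- Write H = G₀ and let M₀ be its unique perfect matching.  Every vertex x of H lies outside core(G), so
-- some maximum stable set S of G misses x.  As G is König–Egerváry, a maximum matching of G matches every
-- vertex outside S into S, and the partners of vertices of H lie in H again; so S ∩ V(H) is a stable set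
-- of H that misses x and contains at least half of V(H).  Hence α(H) = μ(H) = |M₀|.
--
-- If uv ∉ M₀, then M₀ is still a perfect matching of H − uv, so uv is neither α- nor μ-critical.  If
-- uv ∈ M₀, it is μ-critical because a matching of size |M₀| in H − uv would be a second perfect matching
-- of H.  For α-criticality take stable sets Sᵤ ∌ v and Sᵥ ∌ u, each containing half of V(H).  Each meets
-- every edge of M₀ exactly once, so u ∈ X = Sᵤ ∖ Sᵥ and M₀ matches X onto Y = Sᵥ ∖ Sᵤ.  A matching of X
-- into Y inside H − uv could be swapped into M₀, giving a second perfect matching; so by Hall's theorem
-- some W ⊆ X has fewer than |W| neighbours in Y, and W ∪ (Y ∖ N(W)) ∪ (Sᵤ ∩ Sᵥ) is a stable set of
-- H − uv larger than Sᵥ.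

open import Defs
open import Data.Bool using (true)
open import Data.Fin using (Fin)
open import Data.Nat using (ℕ)
open import Relation.Binary.PropositionalEquality using (_≡_)
open import Function.Bundles using (_⇔_)

open import Data.Nat.Properties
open import Algebra.Properties.CommutativeMonoid.Sum +-0-commutativeMonoid
  using (sum; sum-syntax; sum-cong-≗; ∑-distrib-+; ∑-comm; sum-replicate-zero)
open import Data.Bool using (Bool; false; _∧_; _∨_; not; if_then_else_) renaming (_≟_ to _≟ᵇ_)
open import Data.Bool.ListAction using (any)
open import Data.Bool.Properties
  using (∧-conicalˡ; ∧-conicalʳ; ∨-conicalˡ; ∧-zeroʳ; ∧-identityʳ; ∧-comm; ∨-zeroʳ; not-injective;
         T-≡; T-not-≡; ⇔→≡)
open import Data.Empty using (⊥; ⊥-elim)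
open import Data.Fin using (zero; suc; toℕ)
import Data.Fin.Properties as Fin
open import Data.Fin.Subset using (Subset; _∈_; ∣_∣; ⋂)
import Data.Fin.Subset as Subset
open import Data.Fin.Subset.Properties using (anySubset?)
import Data.List as List
open import Data.List.Membership.Propositional using () renaming (_∈_ to _∈ˡ_)
open import Data.List.Membership.Propositional.Properties
  using (∈-map⁺; ∈-map⁻; ∈-++⁺ˡ; ∈-++⁺ʳ; ∈-filter⁺; ∈-filter⁻)
open import Data.List.Properties using (foldr-preservesᵇ; foldr-preservesᵒ; map-cong; map-tabulate)
import Data.List.Relation.Unary.All as All
import Data.List.Relation.Unary.Any as Any
open import Data.List.Relation.Unary.Any using (here; there)
open import Data.List.Relation.Unary.Any.Properties using (any⁺; any⁻; tabulate⁺)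
open import Data.Nat using (zero; suc; _+_; _*_; _⊔_; _≤_; _<_; z≤n; s≤s)
open import Data.Nat.ListAction using () renaming (sum to sumˡ)
open import Data.Product using (Σ-syntax; ∃-syntax; _×_; _,_; proj₁; proj₂)
open import Data.Sum using (_⊎_; inj₁; inj₂; [_,_]′)
import Data.Vec as Vec
open import Data.Vec.Properties
  using ([]=⇒lookup; lookup⇒[]=; lookup∘tabulate; lookup-zipWith; lookup-map; lookup-replicate)
open import Function using (_∘_; id)
open import Function.Bundles using (Equivalence; mk⇔)
open import Function.Construct.Composition using (_⇔-∘_)
open import Function.Construct.Symmetry using (⇔-sym)
open import Relation.Binary using (tri<; tri≈; tri>)
open import Relation.Binary.PropositionalEquality
  using (_≢_; refl; sym; trans; cong; cong₂; subst; subst₂; module ≡-Reasoning)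
open import Relation.Nullary using (¬_; Dec; yes; no)
open import Relation.Nullary.Decidable
  using (⌊_⌋; fromWitness; fromWitnessFalse; toWitness; _×-dec_; _→-dec_)

𝟙 : Bool → ℕ
𝟙 b = if b then 1 else 0

∧-true⁻ : ∀ {a b} → a ∧ b ≡ true → a ≡ true × b ≡ true
∧-true⁻ {a} {b} a∧b = ∧-conicalˡ a b a∧b , ∧-conicalʳ a b a∧b

true≢false : true ≢ false
true≢false ()

∨-true⁻ : ∀ {a b} → a ∨ b ≡ true → a ≡ true ⊎ b ≡ true
∨-true⁻ {true}  _   = inj₁ refl
∨-true⁻ {false} a∨b = inj₂ a∨b

-- Vertex sets and counting

VSet : ℕ → Set
VSet n = Fin n → Bool

EdgeSet : ℕ → Set
EdgeSet n = Fin n → Fin n → Bool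

module _ {n : ℕ} where

  infixr 7 _∩_ _─_
  infixr 6 _∪_
  infix 4 _⊆_

  _∩_ _─_ _∪_ : VSet n → VSet n → VSet n
  (P ∩ Q) i = P i ∧ Q i
  (P ─ Q) i = P i ∧ not (Q i)
  (P ∪ Q) i = P i ∨ Q i

  _⊆_ : VSet n → VSet n → Set
  P ⊆ Q = ∀ i → P i ≡ true → Q i ≡ true

  ⊆-trans : {P Q R : VSet n} → P ⊆ Q → Q ⊆ R → P ⊆ R
  ⊆-trans P⊆Q Q⊆R i = Q⊆R i ∘ P⊆Q i

  ─-disjoint : (P R : VSet n) → ∀ {i} → R i ≡ true → (P ─ R) i ≡ false
  ─-disjoint P R {i} Ri = trans (cong (λ r → P i ∧ not r) Ri) (∧-zeroʳ (P i))

  ⊆-∪─ : (P R : VSet n) → P ⊆ R ∪ (P ─ R)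
  ⊆-∪─ P R i Pi with R i
  ... | true  = refl
  ... | false = trans (∧-identityʳ (P i)) Pi

  ∪─-⊆ : {P R : VSet n} → R ⊆ P → R ∪ (P ─ R) ⊆ P
  ∪─-⊆ {P} {R} R⊆P i R∪P─R with R i in Ri
  ... | true  = R⊆P i Ri
  ... | false = proj₁ (∧-true⁻ R∪P─R)

  ∪-⊆ : {P Q R : VSet n} → P ⊆ R → Q ⊆ R → P ∪ Q ⊆ R
  ∪-⊆ {P} P⊆R Q⊆R i P∪Qi with P i in Pi
  ... | true  = P⊆R i Pi
  ... | false = Q⊆R i P∪Qi

  ∩⊆∪─∩ : (P Q R : VSet n) → P ∩ Q ⊆ R ∪ ((P ─ R) ∩ Q)
  ∩⊆∪─∩ P Q R j PQj with R j
  ... | true  = refl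
  ... | false = trans (cong (_∧ Q j) (∧-identityʳ (P j))) PQj

  ⁅_⁆ : Fin n → VSet n
  ⁅ x ⁆ i = ⌊ i Fin.≟ x ⌋

  x∈⁅x⁆ : ∀ x → ⁅ x ⁆ x ≡ true
  x∈⁅x⁆ x = Equivalence.to T-≡ (fromWitness refl)

  x∈⁅y⁆⇒x≡y : ∀ {x i} → ⁅ x ⁆ i ≡ true → i ≡ x
  x∈⁅y⁆⇒x≡y i≡x = toWitness (Equivalence.from T-≡ i≡x)

  ⁅⁆⊆ : ∀ {P x} → P x ≡ true → ⁅ x ⁆ ⊆ P
  ⁅⁆⊆ {P} Px i i≡x = subst (λ z → P z ≡ true) (sym (x∈⁅y⁆⇒x≡y i≡x)) Px

  count : VSet n → ℕ
  count P = ∑[ i < n ] 𝟙 (P i)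

sum-mono-≤ : ∀ {n} {f g : Fin n → ℕ} → (∀ i → f i ≤ g i) → sum f ≤ sum g
sum-mono-≤ {zero}  f≤g = z≤n
sum-mono-≤ {suc n} f≤g = +-mono-≤ (f≤g zero) (sum-mono-≤ (f≤g ∘ suc))

sum-zero : ∀ {n} {f : Fin n → ℕ} → (∀ i → f i ≡ 0) → sum f ≡ 0
sum-zero {n} f≡0 = trans (sum-cong-≗ f≡0) (sum-replicate-zero n)

sum-mono-≤-tight : ∀ {n} {f g : Fin n → ℕ} → (∀ i → f i ≤ g i) → sum g ≤ sum f → ∀ i → f i ≡ g i
sum-mono-≤-tight {suc n} {f} {g} f≤g g≤f zero =
  ≤-antisym (f≤g zero) (+-cancelʳ-≤ _ _ _ (≤-trans (+-monoʳ-≤ (g zero) (sum-mono-≤ (f≤g ∘ suc))) g≤f))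
sum-mono-≤-tight {suc n} {f} {g} f≤g g≤f (suc i) =
  sum-mono-≤-tight (f≤g ∘ suc) (+-cancelˡ-≤ (f zero) _ _ (≤-trans (+-monoˡ-≤ _ (f≤g zero)) g≤f)) i

module _ {n : ℕ} where

  count-cong : {P Q : VSet n} → (∀ i → P i ≡ Q i) → count P ≡ count Q
  count-cong P≗Q = sum-cong-≗ (cong 𝟙 ∘ P≗Q)

  count-split : (P R : VSet n) → count P ≡ count (P ∩ R) + count (P ─ R)
  count-split P R =
    trans (sum-cong-≗ (λ i → split (P i) (R i))) (∑-distrib-+ (𝟙 ∘ (P ∩ R)) (𝟙 ∘ (P ─ R)))
    where
    split : ∀ p r → 𝟙 p ≡ 𝟙 (p ∧ r) + 𝟙 (p ∧ not r)
    split true  true  = refl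
    split true  false = refl
    split false _     = refl

  count-split-⊆ : {P R : VSet n} → R ⊆ P → count P ≡ count R + count (P ─ R)
  count-split-⊆ {P} {R} R⊆P = trans (count-split P R) (cong (_+ count (P ─ R)) (count-cong P∧R≡R))
    where
    P∧R≡R : ∀ i → P i ∧ R i ≡ R i
    P∧R≡R i with R i in Ri
    ... | true  = trans (∧-identityʳ (P i)) (R⊆P i Ri)
    ... | false = ∧-zeroʳ (P i)

member⇒count-pos : ∀ {n} (P : VSet n) {i} → P i ≡ true → 1 ≤ count P
member⇒count-pos P {zero}  Pi rewrite Pi = s≤s z≤n
member⇒count-pos P {suc i} Pi = ≤-trans (member⇒count-pos (P ∘ suc) Pi) (m≤n+m _ (𝟙 (P zero)))

count-pos⇒member : ∀ {n} (P : VSet n) → 1 ≤ count P → ∃[ i ] P i ≡ true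
count-pos⇒member {suc n} P 1≤∣P∣ with P zero in P0
... | true  = zero , P0
... | false = let i , Pi = count-pos⇒member (P ∘ suc) 1≤∣P∣ in suc i , Pi

count-≤1 : ∀ {n} (P : VSet n) → (∀ j k → P j ≡ true → P k ≡ true → j ≡ k) → count P ≤ 1
count-≤1 {zero}  P unique = z≤n
count-≤1 {suc n} P unique with P zero in P0
... | false = count-≤1 (P ∘ suc) (λ j k Pj Pk → Fin.suc-injective (unique _ _ Pj Pk))
... | true  = ≤-reflexive (cong suc (sum-zero rest-empty))
  where
  rest-empty : ∀ i → 𝟙 (P (suc i)) ≡ 0
  rest-empty i with P (suc i) in Pi
  ... | false = refl
  ... | true  with () ← unique zero (suc i) P0 Pi

module _ {n : ℕ} where

  count-mono : {P Q : VSet n} → P ⊆ Q → count P ≤ count Q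
  count-mono {P} {Q} P⊆Q = sum-mono-≤ λ i → 𝟙-mono (P⊆Q i)
    where
    𝟙-mono : ∀ {a b} → (a ≡ true → b ≡ true) → 𝟙 a ≤ 𝟙 b
    𝟙-mono {false} _   = z≤n
    𝟙-mono {true}  a⇒b rewrite a⇒b refl = ≤-refl

  count-∪ : (P Q : VSet n) → count (P ∪ Q) ≤ count P + count Q
  count-∪ P Q = ≤-trans (sum-mono-≤ λ i → 𝟙-∨ (P i) (Q i)) (≤-reflexive (∑-distrib-+ (𝟙 ∘ P) (𝟙 ∘ Q)))
    where
    𝟙-∨ : ∀ a b → 𝟙 (a ∨ b) ≤ 𝟙 a + 𝟙 b
    𝟙-∨ true  _ = s≤s z≤n
    𝟙-∨ false _ = ≤-refl

  count-disjoint-∪ : (P Q : VSet n) → (∀ i → P i ≡ true → Q i ≡ false) → count (P ∪ Q) ≡ count P + count Q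
  count-disjoint-∪ P Q disjoint =
    trans (sum-cong-≗ λ i → 𝟙-∨ (P i) (Q i) (disjoint i)) (∑-distrib-+ (𝟙 ∘ P) (𝟙 ∘ Q))
    where
    𝟙-∨ : ∀ a b → (a ≡ true → b ≡ false) → 𝟙 (a ∨ b) ≡ 𝟙 a + 𝟙 b
    𝟙-∨ true  b a⇒¬b rewrite a⇒¬b refl = refl
    𝟙-∨ false b _ = refl

  count-⁅⁆ : ∀ (x : Fin n) → count ⁅ x ⁆ ≡ 1
  count-⁅⁆ x = ≤-antisym (count-≤1 ⁅ x ⁆ λ j k j≡x k≡x → trans (x∈⁅y⁆⇒x≡y j≡x) (sym (x∈⁅y⁆⇒x≡y k≡x)))
                         (member⇒count-pos ⁅ x ⁆ (x∈⁅x⁆ x))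

  neighbourhood : EdgeSet n → VSet n → VSet n
  neighbourhood adj W j = any (λ i → W i ∧ adj i j) (List.allFin n)

  neighbourhood-intro : ∀ adj W {i j} → W i ≡ true → adj i j ≡ true → neighbourhood adj W j ≡ true
  neighbourhood-intro adj W {i} Wi Eij =
    Equivalence.to T-≡ (any⁺ _ (tabulate⁺ i (Equivalence.from T-≡ (cong₂ _∧_ Wi Eij))))

  neighbourhood-elim : ∀ adj W {j} → neighbourhood adj W j ≡ true → ∃[ i ] (W i ≡ true × adj i j ≡ true)
  neighbourhood-elim adj W j∈Γ =
    let i , Ti = Any.satisfied (any⁻ _ (List.allFin n) (Equivalence.from T-≡ j∈Γ))
    in i , ∧-true⁻ (Equivalence.to T-≡ Ti)

  neighbourhood-mono : ∀ adj {W W′} → W ⊆ W′ → neighbourhood adj W ⊆ neighbourhood adj W′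
  neighbourhood-mono adj {W} {W′} W⊆W′ j j∈Γ =
    let i , Wi , Eij = neighbourhood-elim adj W j∈Γ in neighbourhood-intro adj W′ (W⊆W′ i Wi) Eij

  anyVSet? : {P : VSet n → Set} → (∀ {W W′} → (∀ i → W i ≡ W′ i) → P W → P W′) → (∀ W → Dec (P W)) →
             Dec (∃[ W ] P W)
  anyVSet? {P} P-resp P? with anySubset? (P? ∘ Vec.lookup)
  ... | yes (S , PS) = yes (Vec.lookup S , PS)
  ... | no ¬PS       = no λ (W , PW) → ¬PS (Vec.tabulate W , P-resp (λ i → sym (lookup∘tabulate W i)) PW)

  _⊆?_ : (P Q : VSet n) → Dec (P ⊆ Q)
  P ⊆? Q = Fin.all? λ i → (P i ≟ᵇ true) →-dec (Q i ≟ᵇ true)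

-- Matchings and double counting

sum-allFin : ∀ {n} (f : Fin n → ℕ) → sumˡ (List.map f (List.allFin n)) ≡ sum f
sum-allFin {n} f = trans (cong sumˡ (map-tabulate id f)) (sum-tabulate f)
  where
  sum-tabulate : ∀ {m} (g : Fin m → ℕ) → sumˡ (List.tabulate g) ≡ sum g
  sum-tabulate {zero}  g = refl
  sum-tabulate {suc m} g = cong (g zero +_) (sum-tabulate (g ∘ suc))

precedes : ∀ {n} → Fin n → Fin n → Bool
precedes i j = ⌊ toℕ i Data.Nat.<? toℕ j ⌋

edgeCount≡∑ : ∀ {n} (M : EdgeSet n) → edgeCount M ≡ ∑[ i < n ] ∑[ j < n ] 𝟙 (precedes i j ∧ M i j)
edgeCount≡∑ {n} M = trans
  (cong sumˡ (map-cong (λ i → sum-allFin (λ j → 𝟙 (precedes i j ∧ M i j))) (List.allFin n)))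
  (sum-allFin (λ i → ∑[ j < n ] 𝟙 (precedes i j ∧ M i j)))

edgeCount-cong : ∀ {n} {R M : EdgeSet n} → (∀ i j → R i j ≡ M i j) → edgeCount R ≡ edgeCount M
edgeCount-cong {R = R} {M} R≗M = trans (edgeCount≡∑ R)
  (trans (sum-cong-≗ λ i → sum-cong-≗ λ j → cong (λ b → 𝟙 (precedes i j ∧ b)) (R≗M i j)) (sym (edgeCount≡∑ M)))

edgeCount-empty : ∀ {n} → edgeCount {n} (λ _ _ → false) ≡ 0
edgeCount-empty {n} = trans (edgeCount≡∑ {n} (λ _ _ → false))
  (sum-zero {n} λ i → sum-zero {n} λ j → cong 𝟙 (∧-zeroʳ (precedes i j)))

MatchesInto : ∀ {n} → EdgeSet n → VSet n → VSet n → Set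
MatchesInto M P Q = ∀ i → P i ≡ true → ∃[ j ] (Q j ≡ true × M i j ≡ true)

vertices : ∀ {n} → Graph n → VSet n
vertices K = Vec.lookup (V K)

edge⇒vertex : ∀ {n} (K : Graph n) {i j} → E K i j ≡ true → vertices K i ≡ true
edge⇒vertex K {i} {j} Eij = []=⇒lookup (E-V K i j Eij)

IsStable : ∀ {n} → Graph n → VSet n → Set
IsStable K S = S ⊆ vertices K × (∀ i j → S i ≡ true → S j ≡ true → E K i j ≡ false)

module MatchingCount {n} (K : Graph n) {M : EdgeSet n} (M-matching : Matching K M) where

  private
    M⊆E : ∀ i j → M i j ≡ true → E K i j ≡ true
    M⊆E = proj₁ M-matching
    M-sym : ∀ i j → M i j ≡ M j i
    M-sym = proj₁ (proj₂ M-matching)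
    M-fun : ∀ i j k → M i j ≡ true → M i k ≡ true → j ≡ k
    M-fun = proj₂ (proj₂ M-matching)

  pairs : VSet n → VSet n → ℕ
  pairs P Q = ∑[ i < n ] count (λ j → P i ∧ Q j ∧ M i j)

  private
    row-≤ : ∀ (P Q : VSet n) i → count (λ j → P i ∧ Q j ∧ M i j) ≤ 𝟙 (P i)
    row-≤ P Q i with P i
    ... | false = ≤-reflexive (sum-zero {n} (λ _ → refl))
    ... | true  = count-≤1 _ λ j k QMj QMk →
                    M-fun i j k (proj₂ (∧-true⁻ QMj)) (proj₂ (∧-true⁻ QMk))

  pairs-≤ : ∀ (P Q : VSet n) → pairs P Q ≤ count P
  pairs-≤ P Q = sum-mono-≤ (row-≤ P Q)

  pairs-full : ∀ {P Q} → MatchesInto M P Q → pairs P Q ≡ count P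
  pairs-full {P} {Q} P↝Q = sum-cong-≗ λ i → ≤-antisym (row-≤ P Q i) (row-≥ i)
    where
    row-≥ : ∀ i → 𝟙 (P i) ≤ count (λ j → P i ∧ Q j ∧ M i j)
    row-≥ i with P i in Pi
    ... | false = z≤n
    ... | true  = let j , Qj , Mij = P↝Q i Pi in member⇒count-pos _ {j} (cong₂ _∧_ Qj Mij)

  pairs-tight : ∀ {P Q} → count P ≤ pairs P Q → MatchesInto M P Q
  pairs-tight {P} {Q} ∣P∣≤ i Pi = j , proj₁ (∧-true⁻ QMij) , proj₂ (∧-true⁻ QMij)
    where
    row≡1 : count (λ j → P i ∧ Q j ∧ M i j) ≡ 1
    row≡1 = trans (sum-mono-≤-tight (row-≤ P Q) ∣P∣≤ i) (cong 𝟙 Pi)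
    witness = count-pos⇒member (λ j → P i ∧ Q j ∧ M i j) (≤-reflexive (sym row≡1))
    j = proj₁ witness
    QMij : Q j ∧ M i j ≡ true
    QMij = proj₂ (∧-true⁻ {P i} (proj₂ witness))

  pairs-comm : ∀ (P Q : VSet n) → pairs P Q ≡ pairs Q P
  pairs-comm P Q = trans (∑-comm (λ i j → 𝟙 (P i ∧ Q j ∧ M i j)))
    (sum-cong-≗ λ j → sum-cong-≗ λ i → cong 𝟙 (swap (P i) (Q j) (M-sym i j)))
    where
    swap : ∀ p q {m m′ : Bool} → m ≡ m′ → p ∧ q ∧ m ≡ q ∧ p ∧ m′
    swap true  true  m≡m′ = m≡m′
    swap true  false _    = refl
    swap false true  _    = refl
    swap false false _    = refl

  pairs-cong : ∀ {P P′ Q Q′} → (∀ i j → M i j ≡ true → P i ∧ Q j ≡ P′ i ∧ Q′ j) →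
               pairs P Q ≡ pairs P′ Q′
  pairs-cong {P} {P′} {Q} {Q′} agree = sum-cong-≗ λ i → sum-cong-≗ λ j → cong 𝟙 (guarded i j)
    where
    vanish : ∀ p q → p ∧ q ∧ false ≡ false
    vanish p q = trans (cong (p ∧_) (∧-zeroʳ q)) (∧-zeroʳ p)
    drop-true : ∀ p q → p ∧ q ∧ true ≡ p ∧ q
    drop-true p q = cong (p ∧_) (∧-identityʳ q)
    guarded : ∀ i j → P i ∧ Q j ∧ M i j ≡ P′ i ∧ Q′ j ∧ M i j
    guarded i j with M i j in Mij
    ... | true  = trans (drop-true (P i) (Q j)) (trans (agree i j Mij) (sym (drop-true (P′ i) (Q′ j))))
    ... | false = trans (vanish (P i) (Q j)) (sym (vanish (P′ i) (Q′ j)))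

  pairs-split : ∀ (P R Q : VSet n) → pairs P Q ≡ pairs (P ∩ R) Q + pairs (P ─ R) Q
  pairs-split P R Q = trans
    (sum-cong-≗ λ i → trans (sum-cong-≗ λ j → split (P i) (R i) (Q j ∧ M i j))
                            (∑-distrib-+ (λ j → 𝟙 ((P ∩ R) i ∧ Q j ∧ M i j)) (λ j → 𝟙 ((P ─ R) i ∧ Q j ∧ M i j))))
    (∑-distrib-+ (λ i → count (λ j → (P ∩ R) i ∧ Q j ∧ M i j)) (λ i → count (λ j → (P ─ R) i ∧ Q j ∧ M i j)))
    where
    split : ∀ p r x → 𝟙 (p ∧ x) ≡ 𝟙 ((p ∧ r) ∧ x) + 𝟙 ((p ∧ not r) ∧ x)
    split true  true  x = sym (+-identityʳ _)
    split true  false x = refl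
    split false r     x = refl

  matchesInto⇒count-≤ : ∀ {P Q} → MatchesInto M P Q → count P ≤ count Q
  matchesInto⇒count-≤ {P} {Q} P↝Q = subst (_≤ count Q) (trans (pairs-comm Q P) (pairs-full P↝Q)) (pairs-≤ Q P)

  matchesInto-converse : ∀ {P Q} → MatchesInto M P Q → count Q ≤ count P → MatchesInto M Q P
  matchesInto-converse {P} {Q} P↝Q ∣Q∣≤∣P∣ =
    pairs-tight (≤-trans ∣Q∣≤∣P∣ (≤-reflexive (sym (trans (pairs-comm Q P) (pairs-full P↝Q)))))

  private
    precedes-true : ∀ {i j : Fin n} → toℕ i Data.Nat.< toℕ j → precedes i j ≡ true
    precedes-true i<j = Equivalence.to T-≡ (fromWitness i<j)

    precedes-false : ∀ {i j : Fin n} → ¬ toℕ i Data.Nat.< toℕ j → precedes i j ≡ false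
    precedes-false i≮j = Equivalence.to T-not-≡ (fromWitnessFalse i≮j)

    split-by-order : ∀ i j → 𝟙 (M i j) ≡ 𝟙 (precedes i j ∧ M i j) + 𝟙 (precedes j i ∧ M i j)
    split-by-order i j with Fin.<-cmp i j
    ... | tri< i<j _ j≮i = sym (trans (cong₂ (λ a b → 𝟙 (a ∧ M i j) + 𝟙 (b ∧ M i j))
                                         (precedes-true i<j) (precedes-false j≮i))
                                  (+-identityʳ _))
    ... | tri> i≮j _ j<i = sym (cong₂ (λ a b → 𝟙 (a ∧ M i j) + 𝟙 (b ∧ M i j))
                                  (precedes-false i≮j) (precedes-true j<i))
    ... | tri≈ _ refl _ with M i i in Mii
    ...   | false = sym (cong₂ _+_ (cong 𝟙 (∧-zeroʳ (precedes i i))) (cong 𝟙 (∧-zeroʳ (precedes i i))))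
    ...   | true  with () ← trans (sym (M⊆E i i Mii)) (E-irr K i)

  univ : VSet n
  univ _ = true

  2*size≡pairs : 2 * edgeCount M ≡ pairs univ univ
  2*size≡pairs = sym (begin
    ∑[ i < n ] ∑[ j < n ] 𝟙 (M i j)
      ≡⟨ sum-cong-≗ (λ i → trans (sum-cong-≗ (split-by-order i)) (∑-distrib-+ (below i) (above i))) ⟩
    ∑[ i < n ] (sum (below i) + sum (above i))
      ≡⟨ ∑-distrib-+ (sum ∘ below) (sum ∘ above) ⟩
    ∑[ i < n ] sum (below i) + ∑[ i < n ] sum (above i)
      ≡⟨ cong (∑[ i < n ] sum (below i) +_) (trans (∑-comm (λ i j → 𝟙 (precedes j i ∧ M i j)))
           (sum-cong-≗ λ j → sum-cong-≗ λ i → cong (λ m → 𝟙 (precedes j i ∧ m)) (M-sym i j))) ⟩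
    ∑[ i < n ] sum (below i) + ∑[ i < n ] sum (below i)
      ≡⟨ cong (∑[ i < n ] sum (below i) +_) (+-identityʳ _) ⟨
    2 * ∑[ i < n ] sum (below i)
      ≡⟨ cong (2 *_) (edgeCount≡∑ M) ⟨
    2 * edgeCount M ∎)
    where
    open ≡-Reasoning
    below above : Fin n → Fin n → ℕ
    below i j = 𝟙 (precedes i j ∧ M i j)
    above i j = 𝟙 (precedes j i ∧ M i j)

  private
    VK : VSet n
    VK = vertices K

    own-vertex : ∀ {i j} → M i j ≡ true → VK i ≡ true
    own-vertex {i} {j} Mij = edge⇒vertex K (M⊆E i j Mij)

    partner-vertex : ∀ {i j} → M i j ≡ true → VK j ≡ true
    partner-vertex {i} {j} Mij = own-vertex (trans (M-sym j i) Mij)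

  Covering : Set
  Covering = ∀ i → i ∈ V K → ∃[ j ] M i j ≡ true

  2*size≡pairs-vertices : 2 * edgeCount M ≡ pairs VK VK
  2*size≡pairs-vertices =
    trans 2*size≡pairs (pairs-cong {univ} {VK} {univ} {VK} λ i j Mij →
      sym (cong₂ _∧_ (own-vertex Mij) (partner-vertex Mij)))

  2*size≤order : 2 * edgeCount M ≤ count VK
  2*size≤order = ≤-trans (≤-reflexive 2*size≡pairs-vertices) (pairs-≤ VK VK)

  covering⇒2*size≡order : Covering → 2 * edgeCount M ≡ count VK
  covering⇒2*size≡order cover = trans 2*size≡pairs-vertices (pairs-full λ i Vi →
    let j , Mij = cover i (lookup⇒[]= i (V K) Vi) in j , partner-vertex Mij , Mij)

  2*size≥order⇒covering : count VK ≤ 2 * edgeCount M → Covering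
  2*size≥order⇒covering ∣V∣≤ i i∈V =
    let j , _ , Mij = pairs-tight (≤-trans ∣V∣≤ (≤-reflexive 2*size≡pairs-vertices)) i ([]=⇒lookup i∈V)
    in j , Mij

  stable⇒2*size≤pairs+∣V─S∣ : ∀ {S} → IsStable K S → 2 * edgeCount M ≤ pairs (VK ─ S) S + count (VK ─ S)
  stable⇒2*size≤pairs+∣V─S∣ {S} (_ , S-indep) = begin
    2 * edgeCount M                           ≡⟨ 2*size≡pairs-vertices ⟩
    pairs VK VK                               ≡⟨ pairs-split VK S VK ⟩
    pairs (VK ∩ S) VK + pairs (VK ─ S) VK     ≡⟨ cong (_+ pairs (VK ─ S) VK) (trans
                                                   (pairs-cong {VK ∩ S} {S} {VK} {VK ─ S} S-edges-leave)
                                                   (pairs-comm S (VK ─ S))) ⟩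
    pairs (VK ─ S) S + pairs (VK ─ S) VK      ≤⟨ +-monoʳ-≤ (pairs (VK ─ S) S) (pairs-≤ (VK ─ S) VK) ⟩
    pairs (VK ─ S) S + count (VK ─ S)         ∎
    where
    open ≤-Reasoning
    S-edges-leave : ∀ i j → M i j ≡ true → (VK i ∧ S i) ∧ VK j ≡ S i ∧ (VK j ∧ not (S j))
    S-edges-leave i j Mij rewrite own-vertex Mij | partner-vertex Mij with S i in Si | S j in Sj
    ... | false | _     = refl
    ... | true  | false = refl
    ... | true  | true  with () ← trans (sym (M⊆E i j Mij)) (S-indep i j Si Sj)

  stable+size≡order⇒complement-matched : ∀ {S} → IsStable K S → count S + edgeCount M ≡ count VK →
                          MatchesInto M (VK ─ S) S
  stable+size≡order⇒complement-matched {S} S-stable ke = pairs-tight (+-cancelʳ-≤ (count (VK ─ S)) _ _ (begin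
    count (VK ─ S) + count (VK ─ S)   ≡⟨ cong (λ m → m + m) ∣V─S∣≡∣M∣ ⟩
    edgeCount M + edgeCount M         ≡⟨ cong (edgeCount M +_) (+-identityʳ _) ⟨
    2 * edgeCount M                   ≤⟨ stable⇒2*size≤pairs+∣V─S∣ S-stable ⟩
    pairs (VK ─ S) S + count (VK ─ S) ∎))
    where
    open ≤-Reasoning
    ∣V─S∣≡∣M∣ : count (VK ─ S) ≡ edgeCount M
    ∣V─S∣≡∣M∣ = +-cancelˡ-≡ (count S) _ _ (trans (sym (count-split-⊆ (proj₁ S-stable))) (sym ke))

  module _ (cover : Covering) {S : VSet n} (S-stable : IsStable K S) where

    private
      ∣V∣≡∣S∣+∣V─S∣ : count VK ≡ count S + count (VK ─ S)
      ∣V∣≡∣S∣+∣V─S∣ = count-split-⊆ (proj₁ S-stable)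

      ∣S∣≤pairs : count S ≤ pairs (VK ─ S) S
      ∣S∣≤pairs = +-cancelʳ-≤ (count (VK ─ S)) _ _ (begin
        count S + count (VK ─ S)           ≡⟨ ∣V∣≡∣S∣+∣V─S∣ ⟨
        count VK                           ≡⟨ covering⇒2*size≡order cover ⟨
        2 * edgeCount M                    ≤⟨ stable⇒2*size≤pairs+∣V─S∣ S-stable ⟩
        pairs (VK ─ S) S + count (VK ─ S)  ∎)
        where open ≤-Reasoning

    stable-≤-half : 2 * count S ≤ count VK
    stable-≤-half = begin
      2 * count S                ≡⟨ cong (count S +_) (+-identityʳ (count S)) ⟩
      count S + count S          ≤⟨ +-monoʳ-≤ (count S) (≤-trans ∣S∣≤pairs (pairs-≤ (VK ─ S) S)) ⟩
      count S + count (VK ─ S)   ≡⟨ ∣V∣≡∣S∣+∣V─S∣ ⟨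
      count VK                   ∎
      where open ≤-Reasoning

    module _ (half : count VK ≤ 2 * count S) where

      half-stable⇒complement-matched : MatchesInto M (VK ─ S) S
      half-stable⇒complement-matched = pairs-tight (≤-trans ∣V─S∣≤∣S∣ ∣S∣≤pairs)
        where
        ∣V─S∣≤∣S∣ : count (VK ─ S) ≤ count S
        ∣V─S∣≤∣S∣ = +-cancelˡ-≤ (count S) _ _ (begin
          count S + count (VK ─ S)   ≡⟨ ∣V∣≡∣S∣+∣V─S∣ ⟨
          count VK                   ≤⟨ half ⟩
          2 * count S                ≡⟨ cong (count S +_) (+-identityʳ (count S)) ⟩
          count S + count S          ∎)
          where open ≤-Reasoning

      half-stable-alternates : ∀ {i j} → M i j ≡ true → S j ≡ not (S i)
      half-stable-alternates {i} {j} Mij with S i in Si | S j in Sj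
      ... | false | true  = refl
      ... | true  | false = refl
      ... | true  | true  with () ← trans (sym (M⊆E i j Mij)) (proj₂ S-stable i j Si Sj)
      ... | false | false
        with k , Sk , Mik ← half-stable⇒complement-matched i (cong₂ _∧_ (own-vertex Mij) (cong not Si))
        with refl ← M-fun i j k Mij Mik
        with () ← trans (sym Sj) Sk

-- Stability and matching numbers

maximum-ub : ∀ {x} xs → x ∈ˡ xs → x ≤ maximum xs
maximum-ub {x} xs x∈xs =
  foldr-preservesᵒ ⊔-preserves 0 xs (inj₂ (Any.map (λ { refl → ≤-refl }) x∈xs))
  where
  ⊔-preserves : ∀ a b → x ≤ a ⊎ x ≤ b → x ≤ a ⊔ b
  ⊔-preserves a b = [ (λ x≤a → ≤-trans x≤a (m≤m⊔n a b)) , (λ x≤b → ≤-trans x≤b (m≤n⊔m a b)) ]′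

maximum-lub : ∀ {m} xs → (∀ {x} → x ∈ˡ xs → x ≤ m) → maximum xs ≤ m
maximum-lub xs bound = foldr-preservesᵇ ⊔-lub z≤n (All.tabulate bound)

maximum-∈ : ∀ xs → maximum xs ∈ˡ 0 List.∷ xs
maximum-∈ xs = foldr-preservesᵇ {P = _∈ˡ 0 List.∷ xs} ⊔-preserves (here refl) (All.tabulate there)
  where
  ⊔-preserves : ∀ {a b} → a ∈ˡ 0 List.∷ xs → b ∈ˡ 0 List.∷ xs → a ⊔ b ∈ˡ 0 List.∷ xs
  ⊔-preserves {a} {b} a∈ b∈ =
    [ (λ a⊔b≡a → subst (_∈ˡ _) (sym a⊔b≡a) a∈) , (λ a⊔b≡b → subst (_∈ˡ _) (sym a⊔b≡b) b∈) ]′ (⊔-sel a b)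

allSubsets-complete : ∀ {n} (S : Subset n) → S ∈ˡ allSubsets n
allSubsets-complete Vec.[] = here refl
allSubsets-complete {suc n} (true Vec.∷ S) = ∈-++⁺ˡ (∈-map⁺ (true Vec.∷_) (allSubsets-complete S))
allSubsets-complete {suc n} (false Vec.∷ S) =
  ∈-++⁺ʳ (List.map (true Vec.∷_) (allSubsets n)) (∈-map⁺ (false Vec.∷_) (allSubsets-complete S))

allVecs-complete : ∀ {A : Set} {xs : List.List A} → (∀ x → x ∈ˡ xs) → ∀ {k} (v : Vec.Vec A k) → v ∈ˡ allVecs xs k
allVecs-complete every Vec.[] = here refl
allVecs-complete {xs = xs} every {suc k} (x Vec.∷ v) = go xs (every x)
  where
  go : ∀ ys → x ∈ˡ ys →
       (x Vec.∷ v) ∈ˡ List.foldr (λ y acc → List.map (y Vec.∷_) (allVecs xs k) List.++ acc) List.[] ys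
  go (y List.∷ ys) (here refl) = ∈-++⁺ˡ (∈-map⁺ (x Vec.∷_) (allVecs-complete every v))
  go (y List.∷ ys) (there x∈ys) = ∈-++⁺ʳ _ (go ys x∈ys)

allRels-complete : ∀ {n} (R : EdgeSet n) → ∃[ R′ ] (R′ ∈ˡ allRels n × (∀ i j → R′ i j ≡ R i j))
allRels-complete {n} R =
  _ , ∈-map⁺ (λ rows i j → Vec.lookup (Vec.lookup rows i) j) (allVecs-complete allSubsets-complete rows) , entries
  where
  rows = Vec.tabulate (λ i → Vec.tabulate (R i))
  entries : ∀ i j → Vec.lookup (Vec.lookup rows i) j ≡ R i j
  entries i j = trans (cong (λ r → Vec.lookup r j) (lookup∘tabulate _ i)) (lookup∘tabulate (R i) j)

∣∣≡count : ∀ {n} (S : Subset n) → ∣ S ∣ ≡ count (Vec.lookup S)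
∣∣≡count Vec.[]          = refl
∣∣≡count (true Vec.∷ S)  = cong suc (∣∣≡count S)
∣∣≡count (false Vec.∷ S) = ∣∣≡count S

module _ {n} (K : Graph n) where

  stable⇒isStable : ∀ {S} → Stable K S → IsStable K (Vec.lookup S)
  stable⇒isStable {S} (S⊆V , indep) =
    (λ i Si → []=⇒lookup (S⊆V (lookup⇒[]= i S Si))) ,
    (λ i j Si Sj → indep i j (lookup⇒[]= i S Si) (lookup⇒[]= j S Sj))

  α-ub : ∀ {P} → IsStable K P → count P ≤ α K
  α-ub {P} (P⊆V , indep) = subst (_≤ α K) ∣S∣≡∣P∣
    (maximum-ub _ (∈-map⁺ ∣_∣ (∈-filter⁺ (stable? K) (allSubsets-complete S) S-stable)))
    where
    S = Vec.tabulate P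
    S≗P : ∀ i → Vec.lookup S i ≡ P i
    S≗P = lookup∘tabulate P
    S-stable : Stable K S
    S-stable = (λ {i} i∈S → lookup⇒[]= i (V K) (P⊆V i (trans (sym (S≗P i)) ([]=⇒lookup i∈S)))) ,
               (λ i j i∈S j∈S → indep i j (trans (sym (S≗P i)) ([]=⇒lookup i∈S))
                                          (trans (sym (S≗P j)) ([]=⇒lookup j∈S)))
    ∣S∣≡∣P∣ : ∣ S ∣ ≡ count P
    ∣S∣≡∣P∣ = trans (∣∣≡count S) (count-cong S≗P)

  α-lub : ∀ {m} → (∀ P → IsStable K P → count P ≤ m) → α K ≤ m
  α-lub {m} bound = maximum-lub _ λ x∈ →
    let S , S∈ , ∣S∣≡x = ∈-map⁻ ∣_∣ x∈
    in subst (_≤ m) (trans (sym (∣∣≡count S)) (sym ∣S∣≡x))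
         (bound _ (stable⇒isStable (proj₂ (∈-filter⁻ (stable? K) {xs = allSubsets n} S∈))))

  μ-ub : ∀ {M} → Matching K M → edgeCount M ≤ μ K
  μ-ub {M} (M⊆E , M-sym , M-fun) = subst (_≤ μ K) (edgeCount-cong R≗M)
    (maximum-ub _ (∈-map⁺ edgeCount (∈-filter⁺ (matching? K) R∈ R-matching)))
    where
    R = proj₁ (allRels-complete M)
    R∈ = proj₁ (proj₂ (allRels-complete M))
    R≗M = proj₂ (proj₂ (allRels-complete M))
    R-matching : Matching K R
    R-matching = (λ i j Rij → M⊆E i j (trans (sym (R≗M i j)) Rij)) ,
                 (λ i j → trans (R≗M i j) (trans (M-sym i j) (sym (R≗M j i)))) ,
                 (λ i j k Rij Rik → M-fun i j k (trans (sym (R≗M i j)) Rij) (trans (sym (R≗M i k)) Rik))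

  μ-attained : ∃[ M ] (Matching K M × edgeCount M ≡ μ K)
  μ-attained with maximum-∈ (List.map edgeCount (List.filter (matching? K) (allRels n)))
  ... | here μ≡0 =
    (λ _ _ → false) , ((λ _ _ ()) , (λ _ _ → refl) , (λ _ _ _ ())) , trans (edgeCount-empty {n}) (sym μ≡0)
  ... | there μ∈ = let M , M∈ , μ≡ = ∈-map⁻ edgeCount μ∈
                   in M , proj₂ (∈-filter⁻ (matching? K) {xs = allRels n} M∈) , sym μ≡

module _ {n} (K : Graph n) where

  isStable-⊆ : ∀ {A S} → A ⊆ S → IsStable K S → IsStable K A
  isStable-⊆ A⊆S (S⊆V , S-indep) = ⊆-trans A⊆S S⊆V , λ i j Ai Aj → S-indep i j (A⊆S i Ai) (A⊆S j Aj)

  isStable-∪ : ∀ {A B} → IsStable K A → IsStable K B → (∀ a b → A a ≡ true → B b ≡ true → E K a b ≡ false) →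
               IsStable K (A ∪ B)
  isStable-∪ {A} {B} (A⊆V , A-indep) (B⊆V , B-indep) no-cross = ∪-⊆ A⊆V B⊆V , indep
    where
    indep : ∀ i j → (A ∪ B) i ≡ true → (A ∪ B) j ≡ true → E K i j ≡ false
    indep i j ABi ABj with ∨-true⁻ ABi | ∨-true⁻ ABj
    ... | inj₁ Ai | inj₁ Aj = A-indep i j Ai Aj
    ... | inj₂ Bi | inj₂ Bj = B-indep i j Bi Bj
    ... | inj₁ Ai | inj₂ Bj = no-cross i j Ai Bj
    ... | inj₂ Bi | inj₁ Aj = trans (E-sym K i j) (no-cross j i Aj Bi)

  α≤size-of-perfect : ∀ {M} → PerfectMatching K M → α K ≤ edgeCount M
  α≤size-of-perfect (M-matching , cover) = α-lub K λ S S-stable →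
    *-cancelˡ-≤ 2 (≤-trans (stable-≤-half cover S-stable) (≤-reflexive (sym (covering⇒2*size≡order cover))))
    where open MatchingCount K M-matching

  μ≡size-of-perfect : ∀ {M} → PerfectMatching K M → μ K ≡ edgeCount M
  μ≡size-of-perfect {M} (M-matching , cover) = ≤-antisym
    (subst (_≤ edgeCount M) (proj₂ (proj₂ (μ-attained K))) (*-cancelˡ-≤ 2 (≤-trans
      (MatchingCount.2*size≤order K (proj₁ (proj₂ (μ-attained K))))
      (≤-reflexive (sym (MatchingCount.covering⇒2*size≡order K M-matching cover))))))
    (μ-ub K M-matching)

  module _ (u v : Fin n) where

    deleteEdge-⊆ : ∀ i j → E (deleteEdge K u v) i j ≡ true → E K i j ≡ true
    deleteEdge-⊆ i j = proj₁ ∘ ∧-true⁻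

    deleteEdge-removes : E (deleteEdge K u v) u v ≡ false
    deleteEdge-removes =
      trans (cong (λ b → E K u v ∧ not (b ∨ (⁅ v ⁆ u ∧ ⁅ u ⁆ v))) (cong₂ _∧_ (x∈⁅x⁆ u) (x∈⁅x⁆ v)))
            (∧-zeroʳ (E K u v))

    isStable-deleteEdge : ∀ {S} → IsStable K S → IsStable (deleteEdge K u v) S
    isStable-deleteEdge (S⊆V , S-indep) = S⊆V , λ i j Si Sj → cong (_∧ _) (S-indep i j Si Sj)

    matching-deleteEdge⁻ : ∀ {M} → Matching (deleteEdge K u v) M → Matching K M
    matching-deleteEdge⁻ (M⊆E , M-rest) = (λ i j → deleteEdge-⊆ i j ∘ M⊆E i j) , M-rest

    matching-deleteEdge⁺ : ∀ {M} → Matching K M → M u v ≡ false → Matching (deleteEdge K u v) M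
    matching-deleteEdge⁺ {M} (M⊆E , M-sym , M-fun) M̸uv = M⊆E′ , M-sym , M-fun
      where
      M⊆E′ : ∀ i j → M i j ≡ true → E (deleteEdge K u v) i j ≡ true
      M⊆E′ i j Mij with isUV u v i j in uv
      ... | false = cong (_∧ true) (M⊆E i j Mij)
      ... | true  = ⊥-elim (true≢false (trans (sym (on-uv uv Mij)) M̸uv))
        where
        on-uv : ∀ {i j} → isUV u v i j ≡ true → M i j ≡ true → M u v ≡ true
        on-uv {i} {j} uv Mij with ∨-true⁻ uv
        ... | inj₁ ij≡uv = let i≡u , j≡v = ∧-true⁻ ij≡uv in
          subst₂ (λ a b → M a b ≡ true) (x∈⁅y⁆⇒x≡y {x = u} i≡u) (x∈⁅y⁆⇒x≡y {x = v} j≡v) Mij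
        ... | inj₂ ij≡vu = let i≡v , j≡u = ∧-true⁻ ij≡vu in
          subst₂ (λ a b → M b a ≡ true) (x∈⁅y⁆⇒x≡y {x = v} i≡v) (x∈⁅y⁆⇒x≡y {x = u} j≡u) (trans (M-sym j i) Mij)

-- The graph G₀ = G − N[core G]

⋂-⊆ : ∀ {n} {S : Subset n} {Ss} → S ∈ˡ Ss → Vec.lookup (⋂ Ss) ⊆ Vec.lookup S
⋂-⊆ {Ss = S′ List.∷ Ss} S∈ i i∈⋂ with ∧-true⁻ (trans (sym (lookup-zipWith _∧_ i S′ (⋂ Ss))) i∈⋂) | S∈
... | i∈S′ , _    | here refl = i∈S′
... | _    , i∈⋂′ | there S∈′ = ⋂-⊆ S∈′ i i∈⋂′

⋂-avoid : ∀ {n} (Ss : List.List (Subset n)) {i} → Vec.lookup (⋂ Ss) i ≡ false →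
          ∃[ S ] (S ∈ˡ Ss × Vec.lookup S i ≡ false)
⋂-avoid List.[] {i} i∉⋂ with () ← trans (sym (lookup-replicate i true)) i∉⋂
⋂-avoid (S List.∷ Ss) {i} i∉⋂ with Vec.lookup S i in Si
... | false = S , here refl , Si
... | true  =
  let S′ , S′∈ , i∉S′ = ⋂-avoid Ss (trans (sym (cong (_∧ _) Si)) (trans (sym (lookup-zipWith _∧_ i S (⋂ Ss))) i∉⋂))
  in S′ , there S′∈ , i∉S′

module _ {n} (G : Graph n) where

  vertices-ᵛ : ∀ (A : Subset n) i → vertices (G -ᵛ A) i ≡ vertices G i ∧ not (Vec.lookup A i)
  vertices-ᵛ A i = trans (lookup-zipWith _∧_ i (V G) (Subset.∁ A)) (cong (vertices G i ∧_) (lookup-map i not A))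

  lookup-N[] : ∀ (C : Subset n) j →
               Vec.lookup (N[ C ] G) j ≡ Vec.lookup C j ∨ neighbourhood (E G) (Vec.lookup C) j
  lookup-N[] C j = trans (lookup-zipWith _∨_ j C (N G C)) (cong (Vec.lookup C j ∨_) (lookup∘tabulate _ j))

  outside-N[] : ∀ (C : Subset n) {y} → vertices (G -ᵛ (N[ C ] G)) y ≡ true →
                Vec.lookup C y ∨ neighbourhood (E G) (Vec.lookup C) y ≡ false
  outside-N[] C {y} y∈V₀ =
    trans (sym (lookup-N[] C y)) (not-injective (proj₂ (∧-true⁻ (trans (sym (vertices-ᵛ (N[ C ] G) y)) y∈V₀))))

  module _ (C : Subset n) {S : VSet n} (S-stable : IsStable G S) (C⊆S : Vec.lookup C ⊆ S) where

    private
      V₀ : VSet n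
      V₀ = vertices (G -ᵛ (N[ C ] G))

    stable-neighbour-survives : ∀ {y s} → V₀ y ≡ true → S s ≡ true → E G y s ≡ true → V₀ s ≡ true
    stable-neighbour-survives {y} {s} y∈V₀ s∈S Eys =
      trans (vertices-ᵛ (N[ C ] G) s)
            (cong₂ _∧_ (edge⇒vertex G Esy) (cong not (trans (lookup-N[] C s) (cong₂ _∨_ s∉C s∉N))))
      where
      Esy : E G s y ≡ true
      Esy = trans (E-sym G s y) Eys
      y∈N[C] : Vec.lookup C s ≡ true → Vec.lookup C y ∨ neighbourhood (E G) (Vec.lookup C) y ≡ true
      y∈N[C] Cs = trans (cong (Vec.lookup C y ∨_) (neighbourhood-intro (E G) (Vec.lookup C) Cs Esy)) (∨-zeroʳ _)
      s∉C : Vec.lookup C s ≡ false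
      s∉C with Vec.lookup C s in Cs
      ... | false = refl
      ... | true  with () ← trans (sym (y∈N[C] Cs)) (outside-N[] C y∈V₀)
      s∉N : neighbourhood (E G) (Vec.lookup C) s ≡ false
      s∉N with neighbourhood (E G) (Vec.lookup C) s in Ns
      ... | false = refl
      ... | true  with c , c∈C , Ecs ← neighbourhood-elim (E G) (Vec.lookup C) Ns
                  with () ← trans (sym Ecs) (proj₂ S-stable c s (C⊆S c c∈C) s∈S)

    trace-stable : IsStable (G -ᵛ (N[ C ] G)) (S ∩ V₀)
    trace-stable = (λ i Ti → proj₂ (∧-true⁻ Ti)) ,
      (λ i j Ti Tj → cong (_∧ (not (Vec.lookup (N[ C ] G) i) ∧ not (Vec.lookup (N[ C ] G) j)))
                          (proj₂ S-stable i j (proj₁ (∧-true⁻ Ti)) (proj₁ (∧-true⁻ Tj))))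

    trace-half : ∀ {M} → Matching G M → count S + edgeCount M ≡ count (vertices G) →
                 count V₀ ≤ 2 * count (S ∩ V₀)
    trace-half {M} M-matching ke = begin
      count V₀                            ≡⟨ count-split V₀ S ⟩
      count (V₀ ∩ S) + count (V₀ ─ S)     ≡⟨ cong (_+ count (V₀ ─ S)) (count-cong (λ i → ∧-comm (V₀ i) (S i))) ⟩
      count (S ∩ V₀) + count (V₀ ─ S)     ≤⟨ +-monoʳ-≤ (count (S ∩ V₀)) (matchesInto⇒count-≤ V₀─S↝S∩V₀) ⟩
      count (S ∩ V₀) + count (S ∩ V₀)     ≡⟨ cong (count (S ∩ V₀) +_) (+-identityʳ _) ⟨
      2 * count (S ∩ V₀)                  ∎
      where
      open ≤-Reasoning
      open MatchingCount G M-matching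
      V₀─S↝S∩V₀ : MatchesInto M (V₀ ─ S) (S ∩ V₀)
      V₀─S↝S∩V₀ y y∈V₀─S =
        let y∈V₀ , y∉S = ∧-true⁻ y∈V₀─S
            y∈V = proj₁ (∧-true⁻ (trans (sym (vertices-ᵛ (N[ C ] G) y)) y∈V₀))
            s , s∈S , Mys = stable+size≡order⇒complement-matched S-stable ke y (cong₂ _∧_ y∈V y∉S)
        in s , cong₂ _∧_ s∈S (stable-neighbour-survives y∈V₀ s∈S (proj₁ M-matching y s Mys)) , Mys

record HalfStableAvoiding {n} (H : Graph n) (x : Fin n) : Set where
  field
    set    : VSet n
    stable : IsStable H set
    avoids : set x ≡ false
    half   : count (vertices H) ≤ 2 * count set

VerticesAvoidedByHalfStables : ∀ {n} → Graph n → Set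
VerticesAvoidedByHalfStables H = ∀ x → vertices H x ≡ true → HalfStableAvoiding H x

G₀-vertices-avoided : ∀ {n} (G : Graph n) → KönigEgerváry G →
                      VerticesAvoidedByHalfStables (G -ᵛ (N[ core G ] G))
G₀-vertices-avoided {n} G ke x x∈V₀ = record
  { set    = S ∩ V₀
  ; stable = trace-stable G (core G) S-stable core⊆S
  ; avoids = cong (_∧ V₀ x) x∉S
  ; half   = trace-half G (core G) S-stable core⊆S M-matching ke′
  }
  where
  V₀ = vertices (G -ᵛ (N[ core G ] G))
  avoiding = ⋂-avoid (Ω G) (∨-conicalˡ _ _ (outside-N[] G (core G) x∈V₀))
  S₀ = proj₁ avoiding
  S₀-max : MaxStable G S₀
  S₀-max = proj₂ (∈-filter⁻ (maxStable? G) {xs = allSubsets n} (proj₁ (proj₂ avoiding)))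
  S = Vec.lookup S₀
  x∉S : S x ≡ false
  x∉S = proj₂ (proj₂ avoiding)
  S-stable : IsStable G S
  S-stable = stable⇒isStable G (proj₁ S₀-max)
  core⊆S : Vec.lookup (core G) ⊆ S
  core⊆S = ⋂-⊆ (proj₁ (proj₂ avoiding))
  M = proj₁ (μ-attained G)
  M-matching = proj₁ (proj₂ (μ-attained G))
  ke′ : count S + edgeCount M ≡ count (vertices G)
  ke′ = trans (cong₂ _+_ (trans (sym (∣∣≡count S₀)) (proj₂ S₀-max)) (proj₂ (proj₂ (μ-attained G))))
              (trans ke (∣∣≡count (V G)))

-- Hall's theorem

module Hall {n} (adj : EdgeSet n) where

  Γ : VSet n → VSet n
  Γ = neighbourhood adj

  HallMatching : VSet n → VSet n → Set
  HallMatching X Y = Σ[ f ∈ (Fin n → Fin n) ]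
    (∀ x → X x ≡ true → Y (f x) ≡ true × adj x (f x) ≡ true) ×
    (∀ x x′ → X x ≡ true → X x′ ≡ true → f x ≡ f x′ → x ≡ x′)

  HallCondition : VSet n → VSet n → Set
  HallCondition X Y = ∀ W → W ⊆ X → count W ≤ count (Y ∩ Γ W)

  Deficient : VSet n → VSet n → VSet n → Set
  Deficient X Y W = W ⊆ X × count (Y ∩ Γ W) < count W

  private
    Critical : VSet n → VSet n → VSet n → Set
    Critical X Y W = W ⊆ X × 1 ≤ count W × count W < count X × count (Y ∩ Γ W) ≤ count W

    critical? : ∀ X Y W → Dec (Critical X Y W)
    critical? X Y W =
      (W ⊆? X) ×-dec (1 ≤? count W) ×-dec (count W <? count X) ×-dec (count (Y ∩ Γ W) ≤? count W)

    deficient? : ∀ X Y W → Dec (Deficient X Y W)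
    deficient? X Y W = (W ⊆? X) ×-dec (count (Y ∩ Γ W) <? count W)

    Γ-cong : ∀ {W W′ : VSet n} → (∀ i → W i ≡ W′ i) → ∀ Y → count (Y ∩ Γ W) ≡ count (Y ∩ Γ W′)
    Γ-cong W≗W′ Y = ≤-antisym (count-mono (∩-monoʳ (neighbourhood-mono adj (λ i → subst (_≡ true) (W≗W′ i)))))
                              (count-mono (∩-monoʳ (neighbourhood-mono adj (λ i → subst (_≡ true) (sym (W≗W′ i))))))
      where
      ∩-monoʳ : ∀ {Q Q′ : VSet n} → Q ⊆ Q′ → Y ∩ Q ⊆ Y ∩ Q′
      ∩-monoʳ Q⊆Q′ i YQi = let Yi , Qi = ∧-true⁻ YQi in cong₂ _∧_ Yi (Q⊆Q′ i Qi)

    transport : ∀ {X W W′ : VSet n} → (∀ i → W i ≡ W′ i) → W ⊆ X → W′ ⊆ X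
    transport W≗W′ W⊆X i W′i = W⊆X i (trans (W≗W′ i) W′i)

    critical-resp : ∀ {X Y W W′ : VSet n} → (∀ i → W i ≡ W′ i) → Critical X Y W → Critical X Y W′
    critical-resp {X} {Y} W≗W′ (W⊆X , 1≤∣W∣ , ∣W∣<∣X∣ , ∣ΓW∣≤∣W∣) =
      transport W≗W′ W⊆X , subst (1 ≤_) ∣W∣≡ 1≤∣W∣ , subst (_< count X) ∣W∣≡ ∣W∣<∣X∣ ,
      subst₂ _≤_ (Γ-cong W≗W′ Y) ∣W∣≡ ∣ΓW∣≤∣W∣
      where ∣W∣≡ = count-cong W≗W′

    deficient-resp : ∀ {X Y W W′ : VSet n} → (∀ i → W i ≡ W′ i) → Deficient X Y W → Deficient X Y W′
    deficient-resp {X} {Y} W≗W′ (W⊆X , ∣ΓW∣<∣W∣) =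
      transport W≗W′ W⊆X , subst₂ _<_ (Γ-cong W≗W′ Y) (count-cong W≗W′) ∣ΓW∣<∣W∣

  hall-mono : ∀ {X X′ Y Y′ : VSet n} → X′ ⊆ X → Y ⊆ Y′ → HallMatching X Y → HallMatching X′ Y′
  hall-mono X′⊆X Y⊆Y′ (f , f-into , f-inj) =
    f , (λ x X′x → let Yfx , Efx = f-into x (X′⊆X x X′x) in Y⊆Y′ (f x) Yfx , Efx) ,
    (λ x x′ X′x X′x′ → f-inj x x′ (X′⊆X x X′x) (X′⊆X x′ X′x′))

  hall-join : ∀ {X₁ X₂ Y₁ Y₂ : VSet n} → (∀ y → Y₁ y ≡ true → Y₂ y ≡ false) →
              HallMatching X₁ Y₁ → HallMatching X₂ Y₂ → HallMatching (X₁ ∪ X₂) (Y₁ ∪ Y₂)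
  hall-join {X₁} {X₂} {Y₁} {Y₂} disjoint (f₁ , f₁-into , f₁-inj) (f₂ , f₂-into , f₂-inj) = f , f-into , f-inj
    where
    f : Fin n → Fin n
    f x = if X₁ x then f₁ x else f₂ x
    f-into : ∀ x → (X₁ ∪ X₂) x ≡ true → (Y₁ ∪ Y₂) (f x) ≡ true × adj x (f x) ≡ true
    f-into x X₁₂x with X₁ x in X₁x
    ... | true  = let Y₁fx , Efx = f₁-into x X₁x in cong (_∨ Y₂ (f₁ x)) Y₁fx , Efx
    ... | false = let Y₂fx , Efx = f₂-into x X₁₂x in trans (cong (Y₁ (f₂ x) ∨_) Y₂fx) (∨-zeroʳ _) , Efx
    f-inj : ∀ x x′ → (X₁ ∪ X₂) x ≡ true → (X₁ ∪ X₂) x′ ≡ true → f x ≡ f x′ → x ≡ x′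
    f-inj x x′ X₁₂x X₁₂x′ fx≡fx′ with X₁ x in X₁x | X₁ x′ in X₁x′
    ... | true  | true  = f₁-inj x x′ X₁x X₁x′ fx≡fx′
    ... | false | false = f₂-inj x x′ X₁₂x X₁₂x′ fx≡fx′
    ... | true  | false with () ← trans (sym (disjoint _ (proj₁ (f₁-into x X₁x))))
                                        (subst (λ y → Y₂ y ≡ true) (sym fx≡fx′) (proj₁ (f₂-into x′ X₁₂x′)))
    ... | false | true  with () ← trans (sym (disjoint _ (proj₁ (f₁-into x′ X₁x′))))
                                        (subst (λ y → Y₂ y ≡ true) fx≡fx′ (proj₁ (f₂-into x X₁₂x)))

  private
    hall-empty : ∀ {X Y : VSet n} → (∀ x → X x ≡ true → ⊥) → HallMatching X Y
    hall-empty X-empty = id , (λ x Xx → ⊥-elim (X-empty x Xx)) , (λ x _ Xx → ⊥-elim (X-empty x Xx))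

    Induction : ℕ → Set
    Induction m = ∀ {X Y : VSet n} → count X ≤ m → HallCondition X Y → HallMatching X Y

    split-at-critical : ∀ {m} {X Y W : VSet n} → Induction m → count X ≤ suc m → HallCondition X Y →
                        Critical X Y W → HallMatching X Y
    split-at-critical {m} {X} {Y} {W} IH ∣X∣≤ hc (W⊆X , 1≤∣W∣ , ∣W∣<∣X∣ , ∣R∣≤∣W∣) =
      hall-mono (⊆-∪─ X W) (∪─-⊆ {P = Y} {R = R} (λ j → proj₁ ∘ ∧-true⁻))
        (hall-join {X₁ = W} {Y₁ = R} (λ _ → ─-disjoint Y R) inner (IH ∣X─W∣≤m outer-condition))
      where
      R = Y ∩ Γ W
      inner : HallMatching W R
      inner = IH (≤-pred (≤-trans ∣W∣<∣X∣ ∣X∣≤)) λ W′ W′⊆W → ≤-trans (hc W′ (⊆-trans W′⊆W W⊆X))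
        (count-mono λ j YΓj → let Yj , Γj = ∧-true⁻ YΓj in
          cong₂ _∧_ (cong₂ _∧_ Yj (neighbourhood-mono adj W′⊆W j Γj)) Γj)
      ∣X─W∣≤m : count (X ─ W) ≤ m
      ∣X─W∣≤m = ≤-pred (≤-trans (+-monoˡ-≤ (count (X ─ W)) 1≤∣W∣) (subst (_≤ suc m) (count-split-⊆ W⊆X) ∣X∣≤))
      outer-condition : HallCondition (X ─ W) (Y ─ R)
      outer-condition W′ W′⊆X─W = +-cancelˡ-≤ (count W) _ _ (begin
        count W + count W′                  ≡⟨ count-disjoint-∪ W W′ W′-avoids-W ⟨
        count (W ∪ W′)                      ≤⟨ hc (W ∪ W′) (∪-⊆ W⊆X (⊆-trans W′⊆X─W (λ i → proj₁ ∘ ∧-true⁻))) ⟩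
        count (Y ∩ Γ (W ∪ W′))              ≤⟨ count-mono Γ-split ⟩
        count (R ∪ ((Y ─ R) ∩ Γ W′))        ≤⟨ count-∪ R ((Y ─ R) ∩ Γ W′) ⟩
        count R + count ((Y ─ R) ∩ Γ W′)    ≤⟨ +-monoˡ-≤ (count ((Y ─ R) ∩ Γ W′)) ∣R∣≤∣W∣ ⟩
        count W + count ((Y ─ R) ∩ Γ W′)    ∎)
        where
        open ≤-Reasoning
        W′-avoids-W : ∀ i → W i ≡ true → W′ i ≡ false
        W′-avoids-W i Wi with W′ i in W′i
        ... | false = refl
        ... | true  with () ← trans (sym (─-disjoint X W Wi)) (W′⊆X─W i W′i)
        Γ-split : Y ∩ Γ (W ∪ W′) ⊆ R ∪ ((Y ─ R) ∩ Γ W′)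
        Γ-split j YΓj with R j in Rj | ∧-true⁻ YΓj
        ... | true  | _ = refl
        ... | false | Yj , Γj with neighbourhood-elim adj (W ∪ W′) Γj
        ...   | i , W∪W′i , Eij with W i in Wi
        ...     | true  with () ← trans (sym Rj) (cong₂ _∧_ Yj (neighbourhood-intro adj W Wi Eij))
        ...     | false = cong₂ _∧_ (cong (_∧ true) Yj) (neighbourhood-intro adj W′ W∪W′i Eij)

    hall-single : ∀ {x y} → adj x y ≡ true → HallMatching ⁅ x ⁆ ⁅ y ⁆
    hall-single {x} {y} adj-xy =
      (λ _ → y) ,
      (λ x′ x′≡x → x∈⁅x⁆ y , subst (λ z → adj z y ≡ true) (sym (x∈⁅y⁆⇒x≡y x′≡x)) adj-xy) ,
      (λ x′ x″ x′≡x x″≡x _ → trans (x∈⁅y⁆⇒x≡y x′≡x) (sym (x∈⁅y⁆⇒x≡y x″≡x)))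

    hall-partner : ∀ {X Y x} → HallCondition X Y → X x ≡ true → ∃[ y ] (Y y ≡ true × adj x y ≡ true)
    hall-partner {X} {Y} {x} hc Xx =
      let y , YΓy = count-pos⇒member (Y ∩ Γ ⁅ x ⁆)
                      (subst (_≤ count (Y ∩ Γ ⁅ x ⁆)) (count-⁅⁆ x) (hc ⁅ x ⁆ (⁅⁆⊆ Xx)))
          Yy , Γy = ∧-true⁻ YΓy
          x′ , x′≡x , adj-x′y = neighbourhood-elim adj ⁅ x ⁆ Γy
      in y , Yy , subst (λ z → adj z y ≡ true) (x∈⁅y⁆⇒x≡y x′≡x) adj-x′y

    peel : ∀ {m} {X Y : VSet n} {x₀} → Induction m → count X ≤ suc m → HallCondition X Y → X x₀ ≡ true →
           (∀ W → ¬ Critical X Y W) → HallMatching X Y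
    peel {m} {X} {Y} {x₀} IH ∣X∣≤ hc Xx₀ none-critical =
      hall-mono (⊆-∪─ X ⁅ x₀ ⁆) (∪─-⊆ (⁅⁆⊆ {P = Y} (proj₁ (proj₂ partner))))
        (hall-join {X₁ = ⁅ x₀ ⁆} {Y₁ = ⁅ y₀ ⁆} (λ _ → ─-disjoint Y ⁅ y₀ ⁆) (hall-single (proj₂ (proj₂ partner)))
                   (IH (≤-pred (subst (_≤ suc m) ∣X∣≡ ∣X∣≤)) surplus))
      where
      partner : ∃[ y ] (Y y ≡ true × adj x₀ y ≡ true)
      partner = hall-partner hc Xx₀
      y₀ = proj₁ partner
      ∣X∣≡ : count X ≡ suc (count (X ─ ⁅ x₀ ⁆))
      ∣X∣≡ = trans (count-split-⊆ (⁅⁆⊆ {P = X} Xx₀)) (cong (_+ count (X ─ ⁅ x₀ ⁆)) (count-⁅⁆ x₀))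
      surplus : HallCondition (X ─ ⁅ x₀ ⁆) (Y ─ ⁅ y₀ ⁆)
      surplus W W⊆ with count W in ∣W∣
      ... | zero  = z≤n
      ... | suc k = ≤-pred (begin-strict
        suc k                                         ≡⟨ ∣W∣ ⟨
        count W                                       <⟨ ∣W∣<∣ΓW∣ ⟩
        count (Y ∩ Γ W)                               ≤⟨ count-mono (∩⊆∪─∩ Y (Γ W) ⁅ y₀ ⁆) ⟩
        count (⁅ y₀ ⁆ ∪ ((Y ─ ⁅ y₀ ⁆) ∩ Γ W))         ≤⟨ count-∪ ⁅ y₀ ⁆ ((Y ─ ⁅ y₀ ⁆) ∩ Γ W) ⟩
        count ⁅ y₀ ⁆ + count ((Y ─ ⁅ y₀ ⁆) ∩ Γ W)     ≡⟨ cong (_+ count ((Y ─ ⁅ y₀ ⁆) ∩ Γ W)) (count-⁅⁆ y₀) ⟩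
        suc (count ((Y ─ ⁅ y₀ ⁆) ∩ Γ W))              ∎)
        where
        open ≤-Reasoning
        W⊆X : W ⊆ X
        W⊆X = ⊆-trans W⊆ (λ i → proj₁ ∘ ∧-true⁻)
        1≤∣W∣ : 1 ≤ count W
        1≤∣W∣ = subst (1 ≤_) (sym ∣W∣) (s≤s z≤n)
        ∣W∣<∣X∣ : count W < count X
        ∣W∣<∣X∣ = subst (count W <_) (sym ∣X∣≡) (s≤s (count-mono W⊆))
        ∣W∣<∣ΓW∣ : count W < count (Y ∩ Γ W)
        ∣W∣<∣ΓW∣ = ≰⇒> λ ∣ΓW∣≤∣W∣ → none-critical W (W⊆X , 1≤∣W∣ , ∣W∣<∣X∣ , ∣ΓW∣≤∣W∣)

  -- Halmos–Vaughan: split X along a critical W if there is one; otherwise every proper W ⊆ X has a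
  -- neighbour to spare, so one edge can be matched and Hall's condition survives on the rest.
  hall : ∀ m {X Y : VSet n} → count X ≤ m → HallCondition X Y → HallMatching X Y
  hall zero    {X} {Y} ∣X∣≤0 _ = hall-empty {X} {Y} λ x Xx → n≮0 (≤-trans (member⇒count-pos X Xx) ∣X∣≤0)
  hall (suc m) {X} {Y} ∣X∣≤ hc with Fin.any? (λ x → X x ≟ᵇ true)
  ... | no  X-empty = hall-empty {X} {Y} λ x Xx → X-empty (x , Xx)
  ... | yes (x₀ , Xx₀) with anyVSet? (critical-resp {X} {Y}) (critical? X Y)
  ...   | yes (W , W-critical) = split-at-critical (hall m) ∣X∣≤ hc W-critical
  ...   | no  none-critical    = peel (hall m) ∣X∣≤ hc Xx₀ (λ W W-critical → none-critical (W , W-critical))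

  hall-or-deficient : ∀ X Y → HallMatching X Y ⊎ ∃[ W ] Deficient X Y W
  hall-or-deficient X Y with anyVSet? (deficient-resp {X} {Y}) (deficient? X Y)
  ... | yes deficiency = inj₂ deficiency
  ... | no  none       = inj₁ (hall (count X) ≤-refl λ W W⊆X → ≮⇒≥ λ ∣ΓW∣<∣W∣ → none (W , W⊆X , ∣ΓW∣<∣W∣))

-- Critical edges of a graph with a unique perfect matching

module Switch {n} (H : Graph n) {M₀ : EdgeSet n} (M₀-perfect : PerfectMatching H M₀)
  {Su Sv : VSet n}
  (Su-alternates : ∀ {i j} → M₀ i j ≡ true → Su j ≡ not (Su i))
  (Sv-alternates : ∀ {i j} → M₀ i j ≡ true → Sv j ≡ not (Sv i)) (Sv⊆V : Sv ⊆ vertices H)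
  {adj : EdgeSet n} (adj⊆E : ∀ i j → adj i j ≡ true → E H i j ≡ true)
  (hall-matching : Hall.HallMatching adj (Su ─ Sv) (Sv ─ Su)) where

  private
    X Y : VSet n
    X = Su ─ Sv
    Y = Sv ─ Su

    f = proj₁ hall-matching
    f-into = proj₁ (proj₂ hall-matching)
    f-inj = proj₂ (proj₂ hall-matching)

    M₀-matching = proj₁ M₀-perfect
    M₀⊆E = proj₁ M₀-matching
    M₀-sym = proj₁ (proj₂ M₀-matching)
    M₀-fun = proj₂ (proj₂ M₀-matching)

    Y⇒¬X : ∀ {i} → Y i ≡ true → X i ≡ false
    Y⇒¬X {i} Yi = trans (cong (λ s → Su i ∧ not s) (proj₁ (∧-true⁻ Yi))) (∧-zeroʳ (Su i))

    outside-X∪Y⇒Su≡Sv : ∀ {i} → X i ≡ false → Y i ≡ false → Su i ≡ Sv i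
    outside-X∪Y⇒Su≡Sv {i} ¬Xi ¬Yi with Su i | Sv i
    ... | true  | true  = refl
    ... | false | false = refl
    ... | true  | false with () ← ¬Xi
    ... | false | true  with () ← ¬Yi

    Su≡Sv⇒outside-X∪Y : ∀ {i} → Su i ≡ Sv i → X i ≡ false × Y i ≡ false
    Su≡Sv⇒outside-X∪Y {i} Su≡Sv with Su i | Sv i
    Su≡Sv⇒outside-X∪Y refl | true  | _ = refl , refl
    Su≡Sv⇒outside-X∪Y refl | false | _ = refl , refl

  M′ : EdgeSet n
  M′ i j = if X i then ⌊ j Fin.≟ f i ⌋ else if Y i then X j ∧ ⌊ i Fin.≟ f j ⌋ else M₀ i j

  data Switched (i j : Fin n) : Set where
    forward  : X i ≡ true → j ≡ f i → Switched i j
    backward : X j ≡ true → i ≡ f j → Switched i j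
    kept     : X i ≡ false → Y i ≡ false → M₀ i j ≡ true → Switched i j

  private
    to-switched : ∀ {i j} → M′ i j ≡ true → Switched i j
    to-switched {i} {j} M′ij with X i in Xi | Y i in Yi
    ... | true  | _     = forward Xi (x∈⁅y⁆⇒x≡y M′ij)
    ... | false | true  = let Xj , i≡fj = ∧-true⁻ M′ij in backward Xj (x∈⁅y⁆⇒x≡y i≡fj)
    ... | false | false = kept Xi Yi M′ij

    from-switched : ∀ {i j} → Switched i j → M′ i j ≡ true
    from-switched {i} (forward Xi refl) rewrite Xi = x∈⁅x⁆ (f i)
    from-switched {j = j} (backward Xj refl)
      rewrite Y⇒¬X (proj₁ (f-into j Xj)) | proj₁ (f-into j Xj) | Xj = x∈⁅x⁆ (f j)
    from-switched (kept ¬Xi ¬Yi M₀ij) rewrite ¬Xi | ¬Yi = M₀ij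

    kept-closed : ∀ {i j} → X i ≡ false → Y i ≡ false → M₀ i j ≡ true → X j ≡ false × Y j ≡ false
    kept-closed ¬Xi ¬Yi M₀ij =
      Su≡Sv⇒outside-X∪Y (trans (Su-alternates M₀ij)
                          (trans (cong not (outside-X∪Y⇒Su≡Sv ¬Xi ¬Yi)) (sym (Sv-alternates M₀ij))))

    f-lands-in-Y : ∀ {i j} → X j ≡ true → i ≡ f j → Y i ≡ true
    f-lands-in-Y Xj refl = proj₁ (f-into _ Xj)

    switched-sym : ∀ {i j} → Switched i j → Switched j i
    switched-sym (forward Xi j≡fi)  = backward Xi j≡fi
    switched-sym (backward Xj i≡fj) = forward Xj i≡fj
    switched-sym {i} {j} (kept ¬Xi ¬Yi M₀ij) =
      let ¬Xj , ¬Yj = kept-closed ¬Xi ¬Yi M₀ij in kept ¬Xj ¬Yj (trans (M₀-sym j i) M₀ij)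

    switched-fun : ∀ {i j k} → Switched i j → Switched i k → j ≡ k
    switched-fun (forward _ j≡fi)    (forward _ k≡fi)    = trans j≡fi (sym k≡fi)
    switched-fun (backward Xj i≡fj)  (backward Xk i≡fk)  = f-inj _ _ Xj Xk (trans (sym i≡fj) i≡fk)
    switched-fun (kept _ _ M₀ij)     (kept _ _ M₀ik)     = M₀-fun _ _ _ M₀ij M₀ik
    switched-fun (forward Xi _)      (backward Xk i≡fk)  with () ← trans (sym Xi) (Y⇒¬X (f-lands-in-Y Xk i≡fk))
    switched-fun (backward Xj i≡fj)  (forward Xi _)      with () ← trans (sym Xi) (Y⇒¬X (f-lands-in-Y Xj i≡fj))
    switched-fun (forward Xi _)      (kept ¬Xi _ _)      with () ← trans (sym Xi) ¬Xi
    switched-fun (kept ¬Xi _ _)      (forward Xi _)      with () ← trans (sym Xi) ¬Xi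
    switched-fun (backward Xj i≡fj)  (kept _ ¬Yi _)      with () ← trans (sym (f-lands-in-Y Xj i≡fj)) ¬Yi
    switched-fun (kept _ ¬Yi _)      (backward Xk i≡fk)  with () ← trans (sym (f-lands-in-Y Xk i≡fk)) ¬Yi

    switched-edge : ∀ {i j} → Switched i j → E H i j ≡ true
    switched-edge {i} (forward Xi refl)  = adj⊆E i (f i) (proj₂ (f-into i Xi))
    switched-edge {j = j} (backward Xj refl) = trans (E-sym H (f j) j) (adj⊆E j (f j) (proj₂ (f-into j Xj)))
    switched-edge {i} {j} (kept _ _ M₀ij)  = M₀⊆E i j M₀ij

  M′-matching : Matching H M′
  M′-matching =
    (λ i j → switched-edge ∘ to-switched) ,
    (λ i j → ⇔→≡ (mk⇔ flip flip)) ,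
    (λ i j k M′ij M′ik → switched-fun (to-switched M′ij) (to-switched M′ik))
    where
    flip : ∀ {i j} → M′ i j ≡ true → M′ j i ≡ true
    flip = from-switched ∘ switched-sym ∘ to-switched

  M′-forward : ∀ x → X x ≡ true → M′ x (f x) ≡ true
  M′-forward x Xx = from-switched (forward Xx refl)

  M′-perfect : PerfectMatching H M′
  M′-perfect = M′-matching , cover
    where
    open MatchingCount H
    ∣Y∣≤∣X∣ : count Y ≤ count X
    ∣Y∣≤∣X∣ = matchesInto⇒count-≤ M₀-matching λ y Yy →
      let Svy , Su̸y = ∧-true⁻ Yy
          j , M₀yj = proj₂ M₀-perfect y (lookup⇒[]= y (V H) (Sv⊆V y Svy))
      in j , cong₂ (λ a b → a ∧ not b) (trans (Su-alternates M₀yj) (cong not (not-injective Su̸y)))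
                                       (trans (Sv-alternates M₀yj) (cong not Svy)) , M₀yj
    Y↝X : MatchesInto M′ Y X
    Y↝X = matchesInto-converse M′-matching (λ x Xx → f x , proj₁ (f-into x Xx) , M′-forward x Xx) ∣Y∣≤∣X∣
    cover : ∀ i → i ∈ V H → ∃[ j ] M′ i j ≡ true
    cover i i∈V = by-cases (X i) refl (Y i) refl
      where
      by-cases : ∀ x → X i ≡ x → ∀ y → Y i ≡ y → ∃[ j ] M′ i j ≡ true
      by-cases true  Xi _     _  = f i , M′-forward i Xi
      by-cases false _  true  Yi = let j , _ , M′ij = Y↝X i Yi in j , M′ij
      by-cases false Xi false Yi = let j , M₀ij = proj₂ M₀-perfect i i∈V in j , from-switched (kept Xi Yi M₀ij)

module UniquelyMatched {n} (H : Graph n) {M₀ : EdgeSet n} (M₀-perfect : PerfectMatching H M₀)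
  (M₀-unique : ∀ M′ → PerfectMatching H M′ → ∀ i j → M′ i j ≡ M₀ i j) (u v : Fin n) where

  private
    H′ = deleteEdge H u v
    VH = vertices H
    k = edgeCount M₀
    M₀-matching = proj₁ M₀-perfect
    M₀⊆E = proj₁ M₀-matching
    M₀-sym = proj₁ (proj₂ M₀-matching)
    M₀-fun = proj₂ (proj₂ M₀-matching)
    open MatchingCount H M₀-matching

    2k≡∣V∣ : 2 * k ≡ count VH
    2k≡∣V∣ = covering⇒2*size≡order (proj₂ M₀-perfect)

    half⇒≥k : ∀ {S : VSet n} → count VH ≤ 2 * count S → k ≤ count S
    half⇒≥k half = *-cancelˡ-≤ 2 (≤-trans (≤-reflexive 2k≡∣V∣) half)

    μH≡k : μ H ≡ k
    μH≡k = μ≡size-of-perfect H M₀-perfect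

  μ-critical⇔matched : μCritical H u v ⇔ M₀ u v ≡ true
  μ-critical⇔matched = mk⇔ to from
    where
    to : μCritical H u v → M₀ u v ≡ true
    to μH′<μH with M₀ u v in M₀uv
    ... | true  = refl
    ... | false = ⊥-elim (<⇒≱ μH′<μH
                    (≤-trans (≤-reflexive μH≡k) (μ-ub H′ (matching-deleteEdge⁺ H u v M₀-matching M₀uv))))
    from : M₀ u v ≡ true → μCritical H u v
    from M₀uv = subst₂ _<_ M-size (sym μH≡k) (≰⇒> M-not-perfect)
      where
      M = proj₁ (μ-attained H′)
      M-matching′ = proj₁ (proj₂ (μ-attained H′))
      M-size = proj₂ (proj₂ (μ-attained H′))
      M-matching = matching-deleteEdge⁻ H u v M-matching′
      M-not-perfect : ¬ k ≤ edgeCount M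
      M-not-perfect k≤∣M∣ = true≢false (trans (sym (proj₁ M-matching′ u v Muv)) (deleteEdge-removes H u v))
        where
        cover = MatchingCount.2*size≥order⇒covering H M-matching
                  (≤-trans (≤-reflexive (sym 2k≡∣V∣)) (*-monoʳ-≤ 2 k≤∣M∣))
        Muv : M u v ≡ true
        Muv = trans (M₀-unique M (M-matching , cover) u v) M₀uv

  module _ (M₀uv : M₀ u v ≡ true) (Tᵤ : HalfStableAvoiding H v) (Tᵥ : HalfStableAvoiding H u) where

    open HalfStableAvoiding Tᵤ using () renaming (set to Su; stable to Su-stable; avoids to v∉Su; half to Su-half)
    open HalfStableAvoiding Tᵥ using () renaming (set to Sv; stable to Sv-stable; avoids to u∉Sv; half to Sv-half)

    private
      X Y : VSet n
      X = Su ─ Sv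
      Y = Sv ─ Su

      Su-alternates = half-stable-alternates (proj₂ M₀-perfect) Su-stable Su-half
      Sv-alternates = half-stable-alternates (proj₂ M₀-perfect) Sv-stable Sv-half

      u∈X : X u ≡ true
      u∈X = cong₂ (λ a b → a ∧ not b) (trans (Su-alternates (trans (M₀-sym v u) M₀uv)) (cong not v∉Su)) u∉Sv

      open Hall (E H′)

      no-hall-matching : ¬ HallMatching X Y
      no-hall-matching hall-matching =
        true≢false (trans (sym E′u[fu]) (subst (λ w → E H′ u w ≡ false) (sym fu≡v) (deleteEdge-removes H u v)))
        where
        open Switch H M₀-perfect Su-alternates Sv-alternates (proj₁ Sv-stable) (deleteEdge-⊆ H u v) hall-matching
        f = proj₁ hall-matching
        E′u[fu] : E H′ u (f u) ≡ true
        E′u[fu] = proj₂ (proj₁ (proj₂ hall-matching) u u∈X)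
        fu≡v : f u ≡ v
        fu≡v = M₀-fun u (f u) v (trans (sym (M₀-unique M′ M′-perfect u (f u))) (M′-forward u u∈X)) M₀uv

    private
      module _ {W : VSet n} (W⊆X : W ⊆ X) where

        private
          A B : VSet n
          A = W ∪ (Su ∩ Sv)
          B = Y ─ Γ W
          A⊆Su : A ⊆ Su
          A⊆Su = ∪-⊆ (⊆-trans W⊆X (λ i → proj₁ ∘ ∧-true⁻)) (λ i → proj₁ ∘ ∧-true⁻)
          B⊆Sv : B ⊆ Sv
          B⊆Sv i = proj₁ ∘ ∧-true⁻ ∘ proj₁ ∘ ∧-true⁻

        enlarged-stable : IsStable H′ (A ∪ B)
        enlarged-stable = isStable-∪ H′ (isStable-⊆ H′ A⊆Su Su′) (isStable-⊆ H′ B⊆Sv Sv′) no-cross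
          where
          Su′ = isStable-deleteEdge H u v Su-stable
          Sv′ = isStable-deleteEdge H u v Sv-stable
          no-cross : ∀ a b → A a ≡ true → B b ≡ true → E H′ a b ≡ false
          no-cross a b Aa Bb with E H′ a b in Eab | ∨-true⁻ Aa
          ... | false | _          = refl
          ... | true  | inj₁ Wa    = ⊥-elim (true≢false (trans (sym (neighbourhood-intro (E H′) W Wa Eab))
                                                               (not-injective (proj₂ (∧-true⁻ Bb)))))
          ... | true  | inj₂ SuSva = sym (trans (sym (proj₂ Sv′ a b (proj₂ (∧-true⁻ SuSva)) (B⊆Sv b Bb))) Eab)

        enlarged-large : count (Y ∩ Γ W) < count W → count Sv < count (A ∪ B)
        enlarged-large ∣YΓW∣<∣W∣ = begin-strict
          count Sv                                        ≡⟨ count-split Sv Su ⟩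
          count (Sv ∩ Su) + count Y                       ≡⟨ cong₂ _+_ (count-cong (λ i → ∧-comm (Sv i) (Su i)))
                                                                       (count-split Y (Γ W)) ⟩
          count (Su ∩ Sv) + (count (Y ∩ Γ W) + count B)  <⟨ +-monoʳ-< (count (Su ∩ Sv))
                                                                       (+-monoˡ-< (count B) ∣YΓW∣<∣W∣) ⟩
          count (Su ∩ Sv) + (count W + count B)          ≡⟨ +-assoc (count (Su ∩ Sv)) (count W) (count B) ⟨
          count (Su ∩ Sv) + count W + count B            ≡⟨ cong (_+ count B) (+-comm (count (Su ∩ Sv)) (count W)) ⟩
          count W + count (Su ∩ Sv) + count B            ≡⟨ cong (_+ count B)
                                                                  (count-disjoint-∪ W (Su ∩ Sv) W-avoids-Sv) ⟨
          count A + count B                              ≡⟨ count-disjoint-∪ A B A-avoids-B ⟨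
          count (A ∪ B)                                  ∎
          where
          open ≤-Reasoning
          W-avoids-Sv : ∀ i → W i ≡ true → (Su ∩ Sv) i ≡ false
          W-avoids-Sv i Wi = trans (cong (Su i ∧_) (not-injective (proj₂ (∧-true⁻ (W⊆X i Wi))))) (∧-zeroʳ (Su i))
          A-avoids-B : ∀ i → A i ≡ true → B i ≡ false
          A-avoids-B i Ai = trans (cong (λ s → (Sv i ∧ not s) ∧ not (Γ W i)) (A⊆Su i Ai))
                                  (cong (_∧ not (Γ W i)) (∧-zeroʳ (Sv i)))

    exceeding-stable : ∃[ Z ] (IsStable H′ Z × count Sv < count Z)
    exceeding-stable with hall-or-deficient X Y
    ... | inj₁ hall-matching          = ⊥-elim (no-hall-matching hall-matching)
    ... | inj₂ (W , W⊆X , deficiency) = _ , enlarged-stable W⊆X , enlarged-large W⊆X deficiency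

  α-critical⇔matched : VerticesAvoidedByHalfStables H → vertices H u ≡ true → αCritical H u v ⇔ M₀ u v ≡ true
  α-critical⇔matched avoided u∈V = mk⇔ to from
    where
    αH≡k : α H ≡ k
    αH≡k = ≤-antisym (α≤size-of-perfect H M₀-perfect)
      (≤-trans (half⇒≥k (HalfStableAvoiding.half T)) (α-ub H (HalfStableAvoiding.stable T)))
      where T = avoided u u∈V
    to : αCritical H u v → M₀ u v ≡ true
    to αH<αH′ with M₀ u v in M₀uv
    ... | true  = refl
    ... | false = ⊥-elim (<⇒≱ αH<αH′ (≤-trans
            (α≤size-of-perfect H′ (matching-deleteEdge⁺ H u v M₀-matching M₀uv , proj₂ M₀-perfect))
            (≤-reflexive (sym αH≡k))))
    from : M₀ u v ≡ true → αCritical H u v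
    from M₀uv = begin-strict
      α H                                  ≡⟨ αH≡k ⟩
      k                                    ≤⟨ half⇒≥k (HalfStableAvoiding.half Tᵥ) ⟩
      count (HalfStableAvoiding.set Tᵥ)    <⟨ proj₂ (proj₂ exceeding) ⟩
      count (proj₁ exceeding)              ≤⟨ α-ub H′ (proj₁ (proj₂ exceeding)) ⟩
      α H′                                 ∎
      where
      open ≤-Reasoning
      Tᵥ = avoided u u∈V
      exceeding = exceeding-stable M₀uv (avoided v (edge⇒vertex H (M₀⊆E v u (trans (M₀-sym v u) M₀uv)))) Tᵥ

lemma4p1 : ∀ {n : ℕ} (G : Graph n) → Connected G → HasEdge G → KönigEgerváry G →
    HasUniquePerfectMatching (G -ᵛ (N[ core G ] G)) →
    ∀ (u v : Fin n) → E (G -ᵛ (N[ core G ] G)) u v ≡ true →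
    (αCritical (G -ᵛ (N[ core G ] G)) u v ⇔ μCritical (G -ᵛ (N[ core G ] G)) u v)
lemma4p1 G _ _ ke (M₀ , M₀-perfect , M₀-unique) u v Euv =
  ⇔-sym μ-critical⇔matched ⇔-∘ α-critical⇔matched (G₀-vertices-avoided G ke) (edge⇒vertex G₀ Euv)
  where
  G₀ = G -ᵛ (N[ core G ] G)
  open UniquelyMatched G₀ M₀-perfect M₀-unique u v
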